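{- A simple game $G$ on a finite set of players is a conjunctive hierarchical game (for some partition of the players into levels $P_1,\dots,P_m$ and some positive thresholds $k_1<\dots<k_{m-1}\le k_m$) if and only if $G$ is complete and its canonical representation has exactly one shift-minimal winning coalition.
   Context: A simple game on a finite set $P$ is a pair $(P,W)$ with $W$ a nonempty family of subsets of $P$ closed under supersets (winning coalitions). The conjunctive hierarchical game with partition $P=P_1\cup\dots\cup P_m$ and thresholds $k_1<\dots<k_{m-1}\le k_m$ has as winning coalitions those $X$ with $|X\cap(P_1\cup\dots\cup P_i)|\ge k_i$ for all $i$. Isbell's desirability relation: $i\succeq_G j$ iff for every $X\subseteq P$ containing neither $i$ nor $j$, $X\cup\{j\}\in W$ implies $X\cup\{i\}\in W$; $G$ is complete if $\succeq_G$ is a total preorder. Players $i,j$ are equivalent if $i\succeq_G j$ and $j\succeq_G i$. If the equivalence classes have sizes $n_1,\dots,n_m$, numbered so that class 1 is strictly more desirable than class 2, etc., the canonical representation is the game on the multiset $\{1^{n_1},\dots,m^{n_m}\}$ in which $\{1^{\ell_1},\dots,m^{\ell_m}\}$ ($0\le\ell_i\le n_i$) is winning iff a coalition with $\ell_i$ players from class $i$ for each $i$ is winning. In this multiset game, $A'$ is obtained from $A=\{1^{\ell_1},\dots,m^{\ell_m}\}$ by a shift if for some $i<j$ with $\ell_i\ge1$ and $\ell_j<n_j$, $A'$ has multiplicities $\ell_i-1$ at $i$, $\ell_j+1$ at $j$ and the same as $A$ elsewhere. A winning submultiset $X$ is shift-minimal if every submultiset strictly contained in $X$ is losing and every submultiset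 obtained from $X$ by a shift is losing. -}

module Defs where

open import Data.Nat using (ℕ; suc; _≤_; _<_; _∸_)
open import Data.Nat.Properties using (_≤?_)
open import Data.Bool using (Bool; true; false)
open import Data.Fin using (Fin; toℕ)
open import Data.Fin.Properties using (_≟_)
open import Data.Fin.Subset using (Subset; _∈_; _∉_; _⊆_; _∪_; _∩_; ⁅_⁆; ∣_∣)
open import Data.Vec using (tabulate)
open import Data.Product using (Σ; Σ-syntax; ∃; _×_)
open import Data.Empty using (⊥)
open import Relation.Nullary using (¬_)
open import Relation.Nullary.Decidable using (⌊_⌋)
open import Relation.Binary.PropositionalEquality using (_≡_; _≢_)
open import Relation.Binary.Structures using (IsTotalPreorder)
open import Function.Bundles using (_⇔_)

record SimpleGame (n : ℕ) : Set where
  field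
    W        : Subset n → Bool
    nonempty : Σ[ X ∈ Subset n ] W X ≡ true
    upward   : ∀ (X Y : Subset n) → X ⊆ Y → W X ≡ true → W Y ≡ true

open SimpleGame public

module _ {n : ℕ} (G : SimpleGame n) where

  Win : Subset n → Set
  Win X = W G X ≡ true

  count : (Fin n → Bool) → Subset n → ℕ
  count P X = ∣ X ∩ tabulate P ∣

  -- Levels: a surjection lvl : Fin n → Fin m (level index 0 is P_1);
  -- surjectivity = all parts P_i are nonempty (a partition).
  -- Thresholds k : Fin m → ℕ with k_1 < ... < k_{m-1} ≤ k_m, i.e. for
  -- consecutive indices i, i+1: k_i ≤ k_{i+1}, strict unless i+1 = m-1.

  record ConjHierarchical (m : ℕ) : Set where
    field
      lvl        : Fin n → Fin m
      lvl-surj   : ∀ (i : Fin m) → Σ[ p ∈ Fin n ] lvl p ≡ i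
      k          : Fin m → ℕ
      k-mono     : ∀ (i j : Fin m) → toℕ j ≡ suc (toℕ i) → k i ≤ k j
      k-strict   : ∀ (i j : Fin m) → toℕ j ≡ suc (toℕ i) → suc (toℕ j) < m → k i < k j
      winning    : ∀ (X : Subset n) →
                   Win X ⇔ (∀ (i : Fin m) → k i ≤ count (λ p → ⌊ toℕ (lvl p) ≤? toℕ i ⌋) X)

  IsConjHierarchical : Set
  IsConjHierarchical = Σ[ m ∈ ℕ ] ConjHierarchical m

  _≽_ : Fin n → Fin n → Set
  i ≽ j = ∀ (X : Subset n) → i ∉ X → j ∉ X → Win (X ∪ ⁅ j ⁆) → Win (X ∪ ⁅ i ⁆)

  Complete : Set
  Complete = IsTotalPreorder _≡_ _≽_

  -- A canonical ranking with m classes is a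
  -- surjection c : Fin n → Fin m onto the equivalence classes, numbered
  -- so that class 0 is the most desirable:  c i ≤ c j  iff  i ≽ j.
  -- (Hence c i ≡ c j iff i, j equivalent, and c i < c j iff i strictly
  -- more desirable than j.)

  record CanonicalRanking (m : ℕ) : Set where
    field
      c       : Fin n → Fin m
      c-surj  : ∀ (k : Fin m) → Σ[ p ∈ Fin n ] c p ≡ k
      c-order : ∀ (i j : Fin n) → (toℕ (c i) ≤ toℕ (c j)) ⇔ (i ≽ j)

  module Canonical {m : ℕ} (R : CanonicalRanking m) where
    open CanonicalRanking R

    inClass : Fin m → Fin n → Bool
    inClass k p = ⌊ c p ≟ k ⌋

    size : Fin m → ℕ
    size k = count (inClass k) (tabulate (λ _ → true))

    -- submultisets {1^ℓ_1, ..., m^ℓ_m} of {1^n_1, ..., m^n_m}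
    Multiset : Set
    Multiset = Fin m → ℕ

    Valid : Multiset → Set
    Valid ℓ = ∀ k → ℓ k ≤ size k

    WinM : Multiset → Set
    WinM ℓ = Σ[ X ∈ Subset n ] ((∀ k → count (inClass k) X ≡ ℓ k) × Win X)

    _⊂ₘ_ : Multiset → Multiset → Set
    ℓ' ⊂ₘ ℓ = (∀ k → ℓ' k ≤ ℓ k) × ¬ (∀ k → ℓ' k ≡ ℓ k)

    Shift : Multiset → Multiset → Set
    Shift ℓ ℓ' = Σ[ i ∈ Fin m ] Σ[ j ∈ Fin m ]
        (toℕ i < toℕ j) × (1 ≤ ℓ i) × (ℓ j < size j)
      × (ℓ' i ≡ ℓ i ∸ 1) × (ℓ' j ≡ suc (ℓ j))
      × (∀ k → k ≢ i → k ≢ j → ℓ' k ≡ ℓ k)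

    ShiftMinimal : Multiset → Set
    ShiftMinimal ℓ = Valid ℓ × WinM ℓ
      × (∀ ℓ' → Valid ℓ' → ℓ' ⊂ₘ ℓ → ¬ WinM ℓ')
      × (∀ ℓ' → Shift ℓ ℓ' → ¬ WinM ℓ')

    ExactlyOneShiftMinimal : Set
    ExactlyOneShiftMinimal = Σ[ ℓ ∈ Multiset ]
      (ShiftMinimal ℓ × (∀ ℓ' → ShiftMinimal ℓ' → ∀ k → ℓ' k ≡ ℓ k))

  -- "its canonical representation has exactly one shift-minimal winning
  -- coalition" (the canonical ranking is unique when it exists)
  CanonicalHasUniqueShiftMinimal : Set
  CanonicalHasUniqueShiftMinimal =
    Σ[ m ∈ ℕ ] Σ[ R ∈ CanonicalRanking m ] Canonical.ExactlyOneShiftMinimal R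

-- Both directions compare coalitions through prefix counts: the number of members lying in the
-- first t levels, or classes.  In a conjunctive hierarchical game players of lower level are more
-- desirable, so the game is complete, and its classes are unions of consecutive levels.  Winning
-- is closed under taking pointwise minima of level prefix counts, so some winning T has least
-- prefix counts among winning coalitions; its profile is shift-minimal, and it is the only one:
-- a winning X whose prefix counts exceed those of T somewhere can drop a player, or move one to a
-- less desirable class, and still dominate T, hence win.
-- Conversely, let ℓ be the unique shift-minimal winning profile and take its prefix sums as
-- thresholds.  Removals and shifts only lower prefix sums and strictly lower a potential, so every
-- winning profile descends to a shift-minimal one, namely ℓ, and meets the thresholds.  A
-- coalition meeting them dominates a realisation of ℓ, and exchanging players for more desirable
-- ones shows that it wins.  Equal consecutive thresholds would make two classes equivalent.

module Submission where

open import Defs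
open import Data.Nat using (ℕ; zero; suc; _+_; _*_; _∸_; _⊓_; _≤_; _<_; z≤n; s≤s)
open import Data.Nat.Properties
open import Data.Bool using (Bool; true; false; _∧_; _∨_; not) renaming (_≟_ to _≟ᵇ_)
open import Data.Bool.Properties using (∨-identityʳ; ∨-zeroʳ; ∧-identityʳ; ∧-zeroʳ)
open import Data.Fin using (Fin; toℕ; fromℕ<) renaming (zero to fzero; suc to fsuc)
open import Data.Fin.Properties renaming (_≟_ to _≟ᶠ_) using (toℕ<n; toℕ-injective; toℕ-fromℕ<; all?; any?; ¬∀⟶∃¬)
open import Data.Fin.Subset using (Subset; _∈_; _∉_; _∪_; _∩_; ⁅_⁆; ∣_∣)
open import Data.Fin.Subset.Properties using (∪-assoc; ∪-comm; x∈p∪q⁻; x∈⁅y⁆⇒x≡y; x∈⁅x⁆; anySubset?; _∈?_)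
open import Data.Vec using ([]; _∷_; lookup; tabulate)
open import Data.Vec.Properties using (lookup∘tabulate; lookup-zipWith; tabulate∘lookup; tabulate-cong; []=⇒lookup; lookup⇒[]=)
open import Data.Product using (Σ-syntax; _×_; _,_; proj₁; proj₂)
open import Data.Sum using (_⊎_; inj₁; inj₂)
open import Data.Empty using (⊥-elim)
open import Data.Unit using (⊤; tt)
open import Relation.Nullary using (¬_; Dec; does; yes; no; contradiction)
open import Relation.Nullary.Decidable using (⌊_⌋; dec-true; decidable-stable; ¬?; _×-dec_; _→-dec_)
open import Relation.Binary.PropositionalEquality
open import Relation.Binary.Definitions using (tri<; tri≈; tri>)
open import Function using (_∘_; case_of_)
open import Induction.WellFounded using (Acc; acc)
open import Data.Nat.Induction using (<-wellFounded)
open import Function.Bundles using (_⇔_; mk⇔; Equivalence)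
open import Algebra.Properties.CommutativeMonoid.Sum +-0-commutativeMonoid
  using (sum; sum-cong-≗; ∑-distrib-+; ∑-comm; sum-replicate-zero)
open import Algebra.Properties.Semiring.Sum +-*-semiring using (*-distribˡ-sum)

𝟙 : Bool → ℕ
𝟙 true  = 1
𝟙 false = 0

𝟙-mono : ∀ {a b} → (a ≡ true → b ≡ true) → 𝟙 a ≤ 𝟙 b
𝟙-mono {false} _ = z≤n
𝟙-mono {true}  h rewrite h refl = ≤-refl

+1≡suc : ∀ m → m + 1 ≡ suc m
+1≡suc m = +-comm m 1

_≡ᵇ_ : ∀ {n} → Fin n → Fin n → Bool
p ≡ᵇ q = does (p ≟ᶠ q)

≡ᵇ-refl : ∀ {n} (p : Fin n) → p ≡ᵇ p ≡ true
≡ᵇ-refl p = dec-true (p ≟ᶠ p) refl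

sum-mono-≤ : ∀ {n} {f g : Fin n → ℕ} → (∀ p → f p ≤ g p) → sum f ≤ sum g
sum-mono-≤ {zero}  h = z≤n
sum-mono-≤ {suc n} h = +-mono-≤ (h fzero) (sum-mono-≤ (h ∘ fsuc))

sum-mono-< : ∀ {n} {f g : Fin n → ℕ} → (∀ p → f p ≤ g p) → ∀ q → f q < g q → sum f < sum g
sum-mono-< {suc n} h fzero    lt = +-mono-<-≤ lt (sum-mono-≤ (h ∘ fsuc))
sum-mono-< {suc n} h (fsuc q) lt = +-mono-≤-< (h fzero) (sum-mono-< (h ∘ fsuc) q lt)

sum-zero : ∀ {n} {f : Fin n → ℕ} → (∀ p → f p ≡ 0) → sum f ≡ 0
sum-zero {n} h = trans (sum-cong-≗ h) (sum-replicate-zero n)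

sum-pick : ∀ {n} (f : Fin n → ℕ) (q : Fin n) → sum (λ p → f p * 𝟙 (p ≡ᵇ q)) ≡ f q
sum-pick {suc n} f fzero = begin
  f fzero * 1 + sum (λ p → f (fsuc p) * 0) ≡⟨ cong₂ _+_ (*-identityʳ (f fzero)) (sum-zero (λ p → *-zeroʳ (f (fsuc p)))) ⟩
  f fzero + 0                              ≡⟨ +-identityʳ (f fzero) ⟩
  f fzero                                  ∎
  where open ≡-Reasoning
sum-pick {suc n} f (fsuc q) = trans (cong (_+ sum (λ p → f (fsuc p) * 𝟙 (p ≡ᵇ q))) (*-zeroʳ (f fzero))) (sum-pick (f ∘ fsuc) q)

pointwise≤∧sum≥⇒≡ : ∀ {n} {f g : Fin n → ℕ} → (∀ p → f p ≤ g p) → sum g ≤ sum f → ∀ p → f p ≡ g p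
pointwise≤∧sum≥⇒≡ f≤g Σg≤Σf p with m≤n⇒m<n∨m≡n (f≤g p)
... | inj₁ lt = contradiction Σg≤Σf (<⇒≱ (sum-mono-< f≤g p lt))
... | inj₂ eq = eq

#ᶠ : ∀ {n} → (Fin n → Bool) → ℕ
#ᶠ P = sum (λ r → 𝟙 (P r))

#ᶠ-mono : ∀ {n} {P Q : Fin n → Bool} → (∀ r → P r ≡ true → Q r ≡ true) → #ᶠ P ≤ #ᶠ Q
#ᶠ-mono P⊆Q = sum-mono-≤ (λ r → 𝟙-mono (P⊆Q r))

#ᶠ-mono-< : ∀ {n} {P Q : Fin n → Bool} → (∀ r → P r ≡ true → Q r ≡ true) →
            ∀ r₀ → P r₀ ≡ false → Q r₀ ≡ true → #ᶠ P < #ᶠ Q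
#ᶠ-mono-< P⊆Q r₀ Pr₀ Qr₀ = sum-mono-< (λ r → 𝟙-mono (P⊆Q r)) r₀
  (subst₂ _<_ (cong 𝟙 (sym Pr₀)) (cong 𝟙 (sym Qr₀)) ≤-refl)

⌊⌋-sound : ∀ {A : Set} (d : Dec A) → ⌊ d ⌋ ≡ true → A
⌊⌋-sound (yes a) _ = a

⌊⌋-complete : ∀ {A : Set} (d : Dec A) → A → ⌊ d ⌋ ≡ true
⌊⌋-complete (yes _) _ = refl
⌊⌋-complete (no ¬a) a = contradiction a ¬a

⌊⌋-false : ∀ {A : Set} (d : Dec A) → ¬ A → ⌊ d ⌋ ≡ false
⌊⌋-false (yes a) ¬a = contradiction a ¬a
⌊⌋-false (no _)  _  = refl

∧-≡true⁻ : ∀ {a b} → a ∧ b ≡ true → a ≡ true × b ≡ true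
∧-≡true⁻ {true} {true} _ = refl , refl

∧-≡true⁺ : ∀ {a b} → a ≡ true → b ≡ true → a ∧ b ≡ true
∧-≡true⁺ refl refl = refl

full : ∀ {n} → Subset n
full = tabulate (λ _ → true)

module _ {n : ℕ} where

  subset-ext : {X Y : Subset n} → (∀ s → lookup X s ≡ lookup Y s) → X ≡ Y
  subset-ext {X} {Y} h = trans (sym (tabulate∘lookup X)) (trans (tabulate-cong h) (tabulate∘lookup Y))

  ∈⇒lookup≡true : {p : Fin n} {X : Subset n} → p ∈ X → lookup X p ≡ true
  ∈⇒lookup≡true = []=⇒lookup

  lookup≡true⇒∈ : {p : Fin n} {X : Subset n} → lookup X p ≡ true → p ∈ X
  lookup≡true⇒∈ {p} {X} = lookup⇒[]= p X

  ∉⇒lookup≡false : {p : Fin n} {X : Subset n} → p ∉ X → lookup X p ≡ false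
  ∉⇒lookup≡false {p} {X} p∉X with lookup X p in eq
  ... | true  = contradiction (lookup≡true⇒∈ eq) p∉X
  ... | false = refl

  lookup≡false⇒∉ : {p : Fin n} {X : Subset n} → lookup X p ≡ false → p ∉ X
  lookup≡false⇒∉ eq p∈X with trans (sym (∈⇒lookup≡true p∈X)) eq
  ... | ()

  lookup-⁅⁆ : ∀ (q s : Fin n) → lookup ⁅ q ⁆ s ≡ s ≡ᵇ q
  lookup-⁅⁆ q s with s ≟ᶠ q
  ... | yes refl = ∈⇒lookup≡true (x∈⁅x⁆ s)
  ... | no s≢q   = ∉⇒lookup≡false (s≢q ∘ x∈⁅y⁆⇒x≡y q)

  lookup-∪⁅⁆ : ∀ (X : Subset n) q s → lookup (X ∪ ⁅ q ⁆) s ≡ lookup X s ∨ s ≡ᵇ q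
  lookup-∪⁅⁆ X q s = trans (lookup-zipWith _∨_ s X ⁅ q ⁆) (cong (lookup X s ∨_) (lookup-⁅⁆ q s))

  ∉-∪⁅⁆ : {A : Subset n} {x y : Fin n} → x ∉ A → x ≢ y → x ∉ A ∪ ⁅ y ⁆
  ∉-∪⁅⁆ {A} {x} {y} x∉A x≢y x∈ with x∈p∪q⁻ A ⁅ y ⁆ x∈
  ... | inj₁ x∈A = x∉A x∈A
  ... | inj₂ x∈y = x≢y (x∈⁅y⁆⇒x≡y y x∈y)

  ∪⁅⁆-comm : ∀ (A : Subset n) x y → (A ∪ ⁅ x ⁆) ∪ ⁅ y ⁆ ≡ (A ∪ ⁅ y ⁆) ∪ ⁅ x ⁆
  ∪⁅⁆-comm A x y = begin
    (A ∪ ⁅ x ⁆) ∪ ⁅ y ⁆  ≡⟨ ∪-assoc A ⁅ x ⁆ ⁅ y ⁆ ⟩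
    A ∪ (⁅ x ⁆ ∪ ⁅ y ⁆)  ≡⟨ cong (A ∪_) (∪-comm ⁅ x ⁆ ⁅ y ⁆) ⟩
    A ∪ (⁅ y ⁆ ∪ ⁅ x ⁆)  ≡⟨ ∪-assoc A ⁅ y ⁆ ⁅ x ⁆ ⟨
    (A ∪ ⁅ y ⁆) ∪ ⁅ x ⁆  ∎
    where open ≡-Reasoning

  remove : Subset n → Fin n → Subset n
  remove X p = tabulate (λ s → lookup X s ∧ not (s ≡ᵇ p))

  lookup-remove : ∀ (X : Subset n) p s → lookup (remove X p) s ≡ lookup X s ∧ not (s ≡ᵇ p)
  lookup-remove X p s = lookup∘tabulate _ s

  ∉-remove : ∀ {X : Subset n} {p} → p ∉ remove X p
  ∉-remove {X} {p} = lookup≡false⇒∉ (begin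
    lookup (remove X p) p       ≡⟨ lookup-remove X p p ⟩
    lookup X p ∧ not (p ≡ᵇ p)   ≡⟨ cong (λ b → lookup X p ∧ not b) (≡ᵇ-refl p) ⟩
    lookup X p ∧ false          ≡⟨ ∧-zeroʳ (lookup X p) ⟩
    false                       ∎)
    where open ≡-Reasoning

  ∉⇒∉-remove : ∀ {X : Subset n} {p q} → q ∉ X → q ∉ remove X p
  ∉⇒∉-remove {X} {p} {q} q∉X = lookup≡false⇒∉
    (trans (lookup-remove X p q) (cong (_∧ not (q ≡ᵇ p)) (∉⇒lookup≡false q∉X)))

  remove-∪⁅⁆ : ∀ {X : Subset n} {p} → p ∈ X → remove X p ∪ ⁅ p ⁆ ≡ X
  remove-∪⁅⁆ {X} {p} p∈X = subset-ext pointwise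
    where
    pointwise : ∀ s → lookup (remove X p ∪ ⁅ p ⁆) s ≡ lookup X s
    pointwise s rewrite lookup-∪⁅⁆ (remove X p) p s | lookup-remove X p s with s ≟ᶠ p
    ... | yes refl = trans (∨-zeroʳ _) (sym (∈⇒lookup≡true p∈X))
    ... | no _     = trans (∨-identityʳ _) (∧-identityʳ _)

  exchange : Subset n → Fin n → Fin n → Subset n
  exchange X p q = remove X p ∪ ⁅ q ⁆

  #[_] : (Fin n → Bool) → Subset n → ℕ
  #[ P ] X = sum (λ s → 𝟙 (lookup X s ∧ P s))

  #-mono : ∀ {P Q : Fin n → Bool} {X Y} →
           (∀ s → lookup X s ∧ P s ≡ true → lookup Y s ∧ Q s ≡ true) → #[ P ] X ≤ #[ Q ] Y
  #-mono h = sum-mono-≤ (λ s → 𝟙-mono (h s))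

  #-mono-< : ∀ {P Q : Fin n → Bool} {X Y} →
             (∀ s → lookup X s ∧ P s ≡ true → lookup Y s ∧ Q s ≡ true) →
             ∀ q → lookup X q ∧ P q ≡ false → lookup Y q ∧ Q q ≡ true → #[ P ] X < #[ Q ] Y
  #-mono-< h q Xq Yq = sum-mono-< (λ s → 𝟙-mono (h s)) q
    (subst₂ _<_ (cong 𝟙 (sym Xq)) (cong 𝟙 (sym Yq)) ≤-refl)

  #-∪⁅⁆ : ∀ (P : Fin n → Bool) {X q} → q ∉ X → #[ P ] (X ∪ ⁅ q ⁆) ≡ #[ P ] X + 𝟙 (P q)
  #-∪⁅⁆ P {X} {q} q∉X = begin
    #[ P ] (X ∪ ⁅ q ⁆)                                       ≡⟨ sum-cong-≗ pointwise ⟩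
    sum (λ s → 𝟙 (lookup X s ∧ P s) + 𝟙 (P s) * 𝟙 (s ≡ᵇ q))  ≡⟨ ∑-distrib-+ (λ s → 𝟙 (lookup X s ∧ P s)) (λ s → 𝟙 (P s) * 𝟙 (s ≡ᵇ q)) ⟩
    #[ P ] X + sum (λ s → 𝟙 (P s) * 𝟙 (s ≡ᵇ q))              ≡⟨ cong (#[ P ] X +_) (sum-pick (𝟙 ∘ P) q) ⟩
    #[ P ] X + 𝟙 (P q)                                       ∎
    where
    open ≡-Reasoning
    pointwise : ∀ s → 𝟙 (lookup (X ∪ ⁅ q ⁆) s ∧ P s) ≡ 𝟙 (lookup X s ∧ P s) + 𝟙 (P s) * 𝟙 (s ≡ᵇ q)
    pointwise s rewrite lookup-∪⁅⁆ X q s with s ≟ᶠ q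
    ... | yes refl rewrite ∉⇒lookup≡false q∉X = sym (*-identityʳ _)
    ... | no _ rewrite ∨-identityʳ (lookup X s) | *-zeroʳ (𝟙 (P s)) = sym (+-identityʳ _)

  #-remove : ∀ (P : Fin n → Bool) {X p} → p ∈ X → #[ P ] (remove X p) + 𝟙 (P p) ≡ #[ P ] X
  #-remove P {X} {p} p∈X = trans (sym (#-∪⁅⁆ P (∉-remove {X}))) (cong #[ P ] (remove-∪⁅⁆ p∈X))

  #-exchange : ∀ (P : Fin n → Bool) {X p q} → p ∈ X → q ∉ X →
               #[ P ] (exchange X p q) + 𝟙 (P p) ≡ #[ P ] X + 𝟙 (P q)
  #-exchange P {X} {p} {q} p∈X q∉X = begin
    #[ P ] (remove X p ∪ ⁅ q ⁆) + 𝟙 (P p)       ≡⟨ cong (_+ 𝟙 (P p)) (#-∪⁅⁆ P (∉⇒∉-remove q∉X)) ⟩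
    #[ P ] (remove X p) + 𝟙 (P q) + 𝟙 (P p)     ≡⟨ +-assoc (#[ P ] (remove X p)) (𝟙 (P q)) (𝟙 (P p)) ⟩
    #[ P ] (remove X p) + (𝟙 (P q) + 𝟙 (P p))   ≡⟨ cong (#[ P ] (remove X p) +_) (+-comm (𝟙 (P q)) (𝟙 (P p))) ⟩
    #[ P ] (remove X p) + (𝟙 (P p) + 𝟙 (P q))   ≡⟨ +-assoc (#[ P ] (remove X p)) (𝟙 (P p)) (𝟙 (P q)) ⟨
    #[ P ] (remove X p) + 𝟙 (P p) + 𝟙 (P q)     ≡⟨ cong (_+ 𝟙 (P q)) (#-remove P p∈X) ⟩
    #[ P ] X + 𝟙 (P q)                          ∎
    where open ≡-Reasoning

∣∩tabulate∣≡# : ∀ {n} (P : Fin n → Bool) (X : Subset n) → ∣ X ∩ tabulate P ∣ ≡ #[ P ] X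
∣∩tabulate∣≡# P [] = refl
∣∩tabulate∣≡# P (b ∷ X) with b ∧ P fzero | ∣∩tabulate∣≡# (P ∘ fsuc) X
... | true  | ih = cong suc ih
... | false | ih = ih

allSubset? : ∀ {n} {P : Subset n → Set} → (∀ X → Dec (P X)) → Dec (∀ X → P X)
allSubset? P? with anySubset? (λ X → ¬? (P? X))
... | yes (X , ¬PX) = no (λ ∀P → ¬PX (∀P X))
... | no ∄¬P        = yes (λ X → decidable-stable (P? X) (λ ¬PX → ∄¬P (X , ¬PX)))

module _ (_⊑_ : ℕ → ℕ → Set) (⊑-refl : ∀ {a} → a ⊑ a)
         (⊑-trans : ∀ {a b c} → a ⊑ b → b ⊑ c → a ⊑ c) (⊑-total : ∀ a b → a ⊑ b ⊎ b ⊑ a) where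

  optimum : ∀ {n} {P : Fin n → Set} → (∀ p → Dec (P p)) → (f : Fin n → ℕ) →
            (∀ p → ¬ P p) ⊎ Σ[ p ∈ Fin n ] (P p × ∀ q → P q → f p ⊑ f q)
  optimum {zero}  P? f = inj₁ λ ()
  optimum {suc n} P? f with optimum (P? ∘ fsuc) (f ∘ fsuc) | P? fzero
  ... | inj₁ none | no ¬P0 = inj₁ λ { fzero → ¬P0 ; (fsuc q) → none q }
  ... | inj₁ none | yes P0 = inj₂ (fzero , P0 , λ { fzero _ → ⊑-refl ; (fsuc q) Pq → contradiction Pq (none q) })
  ... | inj₂ (p , Pp , best) | no ¬P0 =
    inj₂ (fsuc p , Pp , λ { fzero P0 → contradiction P0 ¬P0 ; (fsuc q) Pq → best q Pq })
  ... | inj₂ (p , Pp , best) | yes P0 with ⊑-total (f fzero) (f (fsuc p))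
  ... | inj₁ f0⊑fp = inj₂ (fzero , P0 , λ { fzero _ → ⊑-refl ; (fsuc q) Pq → ⊑-trans f0⊑fp (best q Pq) })
  ... | inj₂ fp⊑f0 = inj₂ (fsuc p , Pp , λ { fzero _ → fp⊑f0 ; (fsuc q) Pq → best q Pq })

argmin : ∀ {n} {P : Fin n → Set} → (∀ p → Dec (P p)) → (f : Fin n → ℕ) →
         (∀ p → ¬ P p) ⊎ Σ[ p ∈ Fin n ] (P p × ∀ q → P q → f p ≤ f q)
argmin = optimum _≤_ ≤-refl ≤-trans ≤-total

argmax : ∀ {n} {P : Fin n → Set} → (∀ p → Dec (P p)) → (f : Fin n → ℕ) →
         (∀ p → ¬ P p) ⊎ Σ[ p ∈ Fin n ] (P p × ∀ q → P q → f q ≤ f p)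
argmax = optimum (λ a b → b ≤ a) ≤-refl (λ b≤a c≤b → ≤-trans c≤b b≤a) (λ a b → ≤-total b a)

least< : ∀ {P : ℕ → Set} → (∀ t → Dec (P t)) → ∀ N →
         (∀ t → t < N → ¬ P t) ⊎ Σ[ a ∈ ℕ ] (a < N × P a × ∀ t → t < a → ¬ P t)
least< P? zero = inj₁ (λ _ ())
least< P? (suc N) with least< P? N
... | inj₂ (a , a<N , Pa , before) = inj₂ (a , m≤n⇒m≤1+n a<N , Pa , before)
... | inj₁ none with P? N
...   | yes PN = inj₂ (N , ≤-refl , PN , none)
...   | no ¬PN = inj₁ λ t t<1+N → case m≤n⇒m<n∨m≡n (≤-pred t<1+N) of λ
        { (inj₁ t<N) → none t t<N ; (inj₂ refl) → ¬PN }

module _ {n : ℕ} (G : SimpleGame n) where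

  Win? : ∀ X → Dec (Win G X)
  Win? X = W G X ≟ᵇ true

  full-wins : Win G full
  full-wins = upward G _ full (λ {s} _ → lookup≡true⇒∈ (lookup∘tabulate _ s)) (proj₂ (nonempty G))

  ≽-refl : ∀ {p} → _≽_ G p p
  ≽-refl X _ _ w = w

  ≽-trans : ∀ {p q r} → _≽_ G p q → _≽_ G q r → _≽_ G p r
  ≽-trans {p} {q} {r} p≽q q≽r X p∉X r∉X w with p ≟ᶠ r | q ∈? X
  ... | yes refl | _       = w
  ... | no _     | no q∉X  = p≽q X p∉X q∉X (q≽r X q∉X r∉X w)
  ... | no p≢r   | yes q∈X = subst (Win G) (restore p) step₂
    where
    B = remove X q
    restore : ∀ x → (B ∪ ⁅ x ⁆) ∪ ⁅ q ⁆ ≡ X ∪ ⁅ x ⁆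
    restore x = trans (∪⁅⁆-comm B x q) (cong (_∪ ⁅ x ⁆) (remove-∪⁅⁆ q∈X))
    q≢r : q ≢ r
    q≢r refl = r∉X q∈X
    q≢p : q ≢ p
    q≢p refl = p∉X q∈X
    step₁ : Win G ((B ∪ ⁅ r ⁆) ∪ ⁅ p ⁆)
    step₁ = p≽q (B ∪ ⁅ r ⁆) (∉-∪⁅⁆ (∉⇒∉-remove p∉X) p≢r) (∉-∪⁅⁆ (∉-remove {X = X}) q≢r)
                (subst (Win G) (sym (restore r)) w)
    step₂ : Win G ((B ∪ ⁅ p ⁆) ∪ ⁅ q ⁆)
    step₂ = q≽r (B ∪ ⁅ p ⁆) (∉-∪⁅⁆ (∉-remove {X = X}) q≢p) (∉-∪⁅⁆ (∉⇒∉-remove r∉X) (p≢r ∘ sym))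
                (subst (Win G) (∪⁅⁆-comm B r p) step₁)

  ≽-dec : ∀ p q → Dec (_≽_ G p q)
  ≽-dec p q = allSubset? (λ X → ¬? (p ∈? X) →-dec ¬? (q ∈? X) →-dec Win? (X ∪ ⁅ q ⁆) →-dec Win? (X ∪ ⁅ p ⁆))

  exchange-wins : ∀ {X p q} → _≽_ G q p → p ∈ X → q ∉ X → Win G X → Win G (exchange X p q)
  exchange-wins {X} q≽p p∈X q∉X w =
    q≽p (remove X _) (∉⇒∉-remove q∉X) (∉-remove {X = X}) (subst (Win G) (sym (remove-∪⁅⁆ p∈X)) w)

𝟙≤?-suc : ∀ x t → 𝟙 ⌊ x ≤? suc t ⌋ ≡ 𝟙 ⌊ x ≤? t ⌋ + 𝟙 ⌊ x ≟ suc t ⌋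
𝟙≤?-suc x t with x ≤? suc t | x ≤? t | x ≟ suc t
... | yes _      | yes _   | no _      = refl
... | yes _      | no _    | yes _     = refl
... | no _       | no _    | no _      = refl
... | yes _      | yes x≤t | yes refl  = contradiction x≤t (<-irrefl refl)
... | yes x≤1+t  | no x≰t  | no x≢1+t  = contradiction (≤-pred (≤∧≢⇒< x≤1+t x≢1+t)) x≰t
... | no x≰1+t   | yes x≤t | _         = contradiction (m≤n⇒m≤1+n x≤t) x≰1+t
... | no x≰1+t   | no _    | yes refl  = contradiction ≤-refl x≰1+t

⌊≤?0⌋ : ∀ x → ⌊ x ≤? 0 ⌋ ≡ ⌊ x ≟ 0 ⌋
⌊≤?0⌋ zero    = refl
⌊≤?0⌋ (suc _) = refl

-- below t x is 𝟙 ⌊ x <? t ⌋, written so that below (suc t) is the prefix weight at t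
below : ℕ → ℕ → ℕ
below zero    _ = 0
below (suc t) x = 𝟙 ⌊ x ≤? t ⌋

𝟙≤?-split : ∀ x t → 𝟙 ⌊ x ≤? t ⌋ ≡ below t x + 𝟙 ⌊ x ≟ t ⌋
𝟙≤?-split x zero    = cong 𝟙 (⌊≤?0⌋ x)
𝟙≤?-split x (suc t) = 𝟙≤?-suc x t

⌊toℕ≟toℕ⌋ : ∀ {m} (b a : Fin m) → ⌊ toℕ b ≟ toℕ a ⌋ ≡ b ≡ᵇ a
⌊toℕ≟toℕ⌋ b a with b ≟ᶠ a
... | yes refl = ⌊⌋-complete (toℕ b ≟ toℕ b) refl
... | no b≢a   = ⌊⌋-false (toℕ b ≟ toℕ a) (b≢a ∘ toℕ-injective)

module _ {n : ℕ} (g : Fin n → ℕ) where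

  prefix : ℕ → Subset n → ℕ
  prefix t = #[ (λ s → ⌊ g s ≤? t ⌋) ]

  layer : ℕ → Subset n → ℕ
  layer t = #[ (λ s → ⌊ g s ≟ t ⌋) ]

  prefix-monoˡ : ∀ {t t'} X → t ≤ t' → prefix t X ≤ prefix t' X
  prefix-monoˡ {t} {t'} X t≤t' = #-mono {X = X} {Y = X} λ s Xs∧gs≤t →
    let (Xs , gs≤t) = ∧-≡true⁻ Xs∧gs≤t
    in ∧-≡true⁺ Xs (⌊⌋-complete (g s ≤? t') (≤-trans (⌊⌋-sound (g s ≤? t) gs≤t) t≤t'))

  prefix-mono-< : ∀ {X Y t q} → (∀ {s} → s ∈ X → g s ≤ t → s ∈ Y) → q ∉ X → q ∈ Y → g q ≤ t →
                  prefix t X < prefix t Y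
  prefix-mono-< {X} {Y} {t} {q} X⊆Y q∉X q∈Y gq≤t = #-mono-< {X = X} {Y = Y} counted q
    (cong (_∧ ⌊ g q ≤? t ⌋) (∉⇒lookup≡false q∉X))
    (∧-≡true⁺ (∈⇒lookup≡true q∈Y) (⌊⌋-complete (g q ≤? t) gq≤t))
    where
    counted : ∀ s → lookup X s ∧ ⌊ g s ≤? t ⌋ ≡ true → lookup Y s ∧ ⌊ g s ≤? t ⌋ ≡ true
    counted s Xs∧gs≤t =
      let (Xs , gs≤t) = ∧-≡true⁻ Xs∧gs≤t
      in ∧-≡true⁺ (∈⇒lookup≡true (X⊆Y (lookup≡true⇒∈ Xs) (⌊⌋-sound (g s ≤? t) gs≤t))) gs≤t

  prefix-stable : ∀ {B} → (∀ p → g p ≤ B) → ∀ {t} X → B ≤ t → prefix t X ≡ prefix B X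
  prefix-stable {B} g≤B {t} X B≤t = sum-cong-≗ λ s → cong (λ b → 𝟙 (lookup X s ∧ b))
    (trans (⌊⌋-complete (g s ≤? t) (≤-trans (g≤B s) B≤t)) (sym (⌊⌋-complete (g s ≤? B) (g≤B s))))

  prefix-zero : ∀ X → prefix 0 X ≡ layer 0 X
  prefix-zero X = sum-cong-≗ λ s → cong (λ b → 𝟙 (lookup X s ∧ b)) (⌊≤?0⌋ (g s))

  prefix-suc : ∀ t X → prefix (suc t) X ≡ prefix t X + layer (suc t) X
  prefix-suc t X = trans (sum-cong-≗ split)
    (∑-distrib-+ (λ s → 𝟙 (lookup X s ∧ ⌊ g s ≤? t ⌋)) (λ s → 𝟙 (lookup X s ∧ ⌊ g s ≟ suc t ⌋)))
    where
    split : ∀ s → 𝟙 (lookup X s ∧ ⌊ g s ≤? suc t ⌋)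
                ≡ 𝟙 (lookup X s ∧ ⌊ g s ≤? t ⌋) + 𝟙 (lookup X s ∧ ⌊ g s ≟ suc t ⌋)
    split s with lookup X s
    ... | true  = 𝟙≤?-suc (g s) t
    ... | false = refl

  layer-empty : ∀ {t X} → (∀ {s} → s ∈ X → g s ≢ t) → layer t X ≡ 0
  layer-empty {t} {X} none = sum-zero pointwise
    where
    pointwise : ∀ s → 𝟙 (lookup X s ∧ ⌊ g s ≟ t ⌋) ≡ 0
    pointwise s with lookup X s in Xs | g s ≟ t
    ... | false | _       = refl
    ... | true  | no _    = refl
    ... | true  | yes gs≡t = contradiction gs≡t (none (lookup≡true⇒∈ Xs))

  layer-mono : ∀ {t X Y} → (∀ {s} → s ∈ X → g s ≡ t → s ∈ Y) → layer t X ≤ layer t Y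
  layer-mono {t} {X} {Y} X⊆Y = #-mono {X = X} {Y = Y} λ s Xs∧gs≡t →
    let (Xs , gs≡t) = ∧-≡true⁻ Xs∧gs≡t
    in ∧-≡true⁺ (∈⇒lookup≡true (X⊆Y (lookup≡true⇒∈ Xs) (⌊⌋-sound (g s ≟ t) gs≡t))) gs≡t

  prefix-∪⁅⁆ : ∀ {t Z q} → q ∉ Z → prefix t (Z ∪ ⁅ q ⁆) ≡ prefix t Z + 𝟙 ⌊ g q ≤? t ⌋
  prefix-∪⁅⁆ = #-∪⁅⁆ _

  prefix-remove : ∀ {t X p} → p ∈ X → prefix t (remove X p) + 𝟙 ⌊ g p ≤? t ⌋ ≡ prefix t X
  prefix-remove = #-remove _

  prefix-exchange : ∀ {t X p q} → p ∈ X → q ∉ X →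
                    prefix t (exchange X p q) + 𝟙 ⌊ g p ≤? t ⌋ ≡ prefix t X + 𝟙 ⌊ g q ≤? t ⌋
  prefix-exchange = #-exchange _

-- Domination

module _ {n : ℕ} (G : SimpleGame n) (g : Fin n → ℕ) (monotone : ∀ p q → g p ≤ g q → _≽_ G p q) where

  Dominated : Subset n → Subset n → Set
  Dominated X Y = ∀ r → prefix g (g r) X ≤ prefix g (g r) Y

  ∣_∖_∣ : Subset n → Subset n → ℕ
  ∣ X ∖ Y ∣ = #[ (λ s → not (lookup Y s)) ] X

  -- Exchange a member p of X ∖ Y of least grade for a member q of Y ∖ X of grade ≤ g p;
  -- without such a q, Y would have fewer players than X of grade ≤ g p.
  dominates-step : ∀ {X Y} → Dominated X Y → Win G X →
    Win G Y ⊎ Σ[ X' ∈ Subset n ] (Win G X' × Dominated X' Y × ∣ X' ∖ Y ∣ < ∣ X ∖ Y ∣)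
  dominates-step {X} {Y} X≤Y w with argmin (λ s → s ∈? X ×-dec ¬? (s ∈? Y)) g
  ... | inj₁ X⊆Y = inj₁ (upward G X Y (λ {s} s∈X → decidable-stable (s ∈? Y) (λ s∉Y → X⊆Y s (s∈X , s∉Y))) w)
  ... | inj₂ (p , (p∈X , p∉Y) , p-least) with any? (λ q → q ∈? Y ×-dec ¬? (q ∈? X) ×-dec g q ≤? g p)
  ... | no ∄q = contradiction (X≤Y p) (<⇒≱ (prefix-mono-< g Y⊆X p∉Y p∈X ≤-refl))
    where
    Y⊆X : ∀ {s} → s ∈ Y → g s ≤ g p → s ∈ X
    Y⊆X {s} s∈Y gs≤gp = decidable-stable (s ∈? X) (λ s∉X → ∄q (s , s∈Y , s∉X , gs≤gp))
  ... | yes (q , q∈Y , q∉X , gq≤gp) =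
    inj₂ (exchange X p q , exchange-wins G (monotone q p gq≤gp) p∈X q∉X w , bounded , fewer)
    where
    bounded : Dominated (exchange X p q) Y
    bounded r with g p ≤? g r | g q ≤? g r | prefix-exchange g {g r} p∈X q∉X
    ... | yes _     | yes _ | eq = ≤-trans (≤-reflexive (+-cancelʳ-≡ _ _ _ eq)) (X≤Y r)
    ... | no _      | no _  | eq = ≤-trans (≤-reflexive (trans (sym (+-identityʳ _)) (trans eq (+-identityʳ _)))) (X≤Y r)
    ... | yes gp≤gr | no gq≰gr | _ = contradiction (≤-trans gq≤gp gp≤gr) gq≰gr
    ... | no gp≰gr  | yes gq≤gr | eq = ≤-trans (≤-reflexive (trans (sym (+-identityʳ _)) (trans eq (+1≡suc _))))
                                             (prefix-mono-< g X⊆Y q∉X q∈Y gq≤gr)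
      where
      X⊆Y : ∀ {s} → s ∈ X → g s ≤ g r → s ∈ Y
      X⊆Y {s} s∈X gs≤gr = decidable-stable (s ∈? Y)
        (λ s∉Y → gp≰gr (≤-trans (p-least s (s∈X , s∉Y)) gs≤gr))
    fewer : ∣ exchange X p q ∖ Y ∣ < ∣ X ∖ Y ∣
    fewer = ≤-reflexive (begin
      suc ∣ exchange X p q ∖ Y ∣                                 ≡⟨ +1≡suc _ ⟨
      ∣ exchange X p q ∖ Y ∣ + 1                                 ≡⟨ cong (λ b → ∣ exchange X p q ∖ Y ∣ + 𝟙 (not b)) (∉⇒lookup≡false p∉Y) ⟨
      ∣ exchange X p q ∖ Y ∣ + 𝟙 (not (lookup Y p))             ≡⟨ #-exchange _ p∈X q∉X ⟩
      ∣ X ∖ Y ∣ + 𝟙 (not (lookup Y q))                          ≡⟨ cong (λ b → ∣ X ∖ Y ∣ + 𝟙 (not b)) (∈⇒lookup≡true q∈Y) ⟩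
      ∣ X ∖ Y ∣ + 0                                             ≡⟨ +-identityʳ _ ⟩
      ∣ X ∖ Y ∣                                                 ∎)
      where open ≡-Reasoning

  dominates : ∀ {X Y} → Dominated X Y → Win G X → Win G Y
  dominates {X} {Y} = go (<-wellFounded ∣ X ∖ Y ∣)
    where
    go : ∀ {X} → Acc _<_ ∣ X ∖ Y ∣ → Dominated X Y → Win G X → Win G Y
    go (acc smaller) X≤Y w with dominates-step X≤Y w
    ... | inj₁ wY = wY
    ... | inj₂ (X' , w' , X'≤Y , fewer) = go (smaller fewer) X'≤Y w'

-- Descent

module _ {n : ℕ} (g : Fin n → ℕ) where

  Gap : Subset n → Subset n → ℕ → Set
  Gap X Y t = prefix g t Y < prefix g t X

  record Improvement (X Y : Subset n) (p : Fin n) (X' : Subset n) : Set where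
    field
      ≥-min   : ∀ t → prefix g t X ⊓ prefix g t Y ≤ prefix g t X'
      ≤-orig  : ∀ t → prefix g t X' ≤ prefix g t X
      <-orig  : prefix g (g p) X' < prefix g (g p) X

  drop-improves : ∀ {X Y p} → p ∈ X → (∀ t → g p ≤ t → Gap X Y t) → Improvement X Y p (remove X p)
  drop-improves {X} {Y} {p} p∈X gap = record { ≥-min = ≥-min ; ≤-orig = ≤-orig ; <-orig = <-orig }
    where
    X' = remove X p
    ≥-min : ∀ t → prefix g t X ⊓ prefix g t Y ≤ prefix g t X'
    ≥-min t with g p ≤? t | prefix-remove g {t} p∈X
    ... | yes gp≤t | eq = ≤-trans (m⊓n≤n _ _) (≤-pred (subst (prefix g t Y <_) (trans (sym eq) (+1≡suc _)) (gap t gp≤t)))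
    ... | no _     | eq = ≤-trans (m⊓n≤m _ _) (≤-reflexive (trans (sym eq) (+-identityʳ _)))
    ≤-orig : ∀ t → prefix g t X' ≤ prefix g t X
    ≤-orig t = ≤-trans (m≤m+n _ _) (≤-reflexive (prefix-remove g p∈X))
    <-orig : prefix g (g p) X' < prefix g (g p) X
    <-orig with g p ≤? g p | prefix-remove g {g p} p∈X
    ... | yes _    | eq = ≤-reflexive (trans (sym (+1≡suc _)) eq)
    ... | no gp≰gp | _  = contradiction ≤-refl gp≰gp

  swap-improves : ∀ {X Y p q} → p ∈ X → q ∉ X → g p < g q → (∀ t → g p ≤ t → t < g q → Gap X Y t) →
                  Improvement X Y p (exchange X p q)
  swap-improves {X} {Y} {p} {q} p∈X q∉X gp<gq gap = record { ≥-min = ≥-min ; ≤-orig = ≤-orig ; <-orig = <-orig }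
    where
    X' = exchange X p q
    unchanged : ∀ {t} → prefix g t X' + 0 ≡ prefix g t X + 0 → prefix g t X' ≡ prefix g t X
    unchanged eq = trans (sym (+-identityʳ _)) (trans eq (+-identityʳ _))
    ≥-min : ∀ t → prefix g t X ⊓ prefix g t Y ≤ prefix g t X'
    ≥-min t with g p ≤? t | g q ≤? t | prefix-exchange g {t} p∈X q∉X
    ... | yes _    | yes _    | eq = ≤-trans (m⊓n≤m _ _) (≤-reflexive (sym (+-cancelʳ-≡ _ _ _ eq)))
    ... | no _     | no _     | eq = ≤-trans (m⊓n≤m _ _) (≤-reflexive (sym (unchanged eq)))
    ... | no gp≰t  | yes gq≤t | _  = contradiction (<⇒≤ (<-≤-trans gp<gq gq≤t)) gp≰t
    ... | yes gp≤t | no gq≰t  | eq = ≤-trans (m⊓n≤n _ _)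
      (≤-pred (subst (prefix g t Y <_) (trans (sym (+-identityʳ _)) (trans (sym eq) (+1≡suc _))) (gap t gp≤t (≰⇒> gq≰t))))
    ≤-orig : ∀ t → prefix g t X' ≤ prefix g t X
    ≤-orig t with g p ≤? t | g q ≤? t | prefix-exchange g {t} p∈X q∉X
    ... | yes _    | yes _    | eq = ≤-reflexive (+-cancelʳ-≡ _ _ _ eq)
    ... | no _     | no _     | eq = ≤-reflexive (unchanged eq)
    ... | no gp≰t  | yes gq≤t | _  = contradiction (<⇒≤ (<-≤-trans gp<gq gq≤t)) gp≰t
    ... | yes _    | no _     | eq = ≤-trans (m≤m+n _ 1) (≤-reflexive (trans eq (+-identityʳ _)))
    <-orig : prefix g (g p) X' < prefix g (g p) X
    <-orig with g p ≤? g p | g q ≤? g p | prefix-exchange g {g p} p∈X q∉X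
    ... | yes _ | no _     | eq = ≤-reflexive (trans (sym (+1≡suc _)) (trans eq (+-identityʳ _)))
    ... | _     | yes gq≤gp | _ = contradiction gq≤gp (<⇒≱ gp<gq)
    ... | no gp≰gp | _     | _  = contradiction ≤-refl gp≰gp

  data Descent (X Y : Subset n) : Set where
    drop : ∀ {p} → p ∈ X → Improvement X Y p (remove X p) → Descent X Y
    swap : ∀ {p q} → p ∈ X → q ∉ X → g p < g q → Improvement X Y p (exchange X p q) → Descent X Y

  module _ {X Y : Subset n} where

    no-gap-at-empty-layer : ∀ a → (∀ t → t < a → ¬ Gap X Y t) → layer g a X ≡ 0 → ¬ Gap X Y a
    no-gap-at-empty-layer zero _ empty gap₀ =
      contradiction (subst (prefix g 0 Y <_) (trans (prefix-zero g X) empty) gap₀) (λ ())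
    no-gap-at-empty-layer (suc a) before empty = ≤⇒≯ (begin
      prefix g (suc a) X                ≡⟨ prefix-suc g a X ⟩
      prefix g a X + layer g (suc a) X  ≡⟨ cong (prefix g a X +_) empty ⟩
      prefix g a X + 0                  ≡⟨ +-identityʳ _ ⟩
      prefix g a X                      ≤⟨ ≮⇒≥ (before a ≤-refl) ⟩
      prefix g a Y                      ≤⟨ m≤m+n _ _ ⟩
      prefix g a Y + layer g (suc a) Y  ≡⟨ prefix-suc g a Y ⟨
      prefix g (suc a) Y                ∎)
      where open ≤-Reasoning

    member-at-first-gap : ∀ {a} → Gap X Y a → (∀ t → t < a → ¬ Gap X Y t) → Σ[ p ∈ Fin n ] (p ∈ X × g p ≡ a)
    member-at-first-gap {a} gapₐ before with any? (λ p → p ∈? X ×-dec g p ≟ a)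
    ... | yes found = found
    ... | no ∄p = contradiction gapₐ
      (no-gap-at-empty-layer a before (layer-empty g (λ {s} s∈X gs≡a → ∄p (s , s∈X , gs≡a))))

    absent-at-closing : ∀ {t} → Gap X Y t → ¬ Gap X Y (suc t) → Σ[ q ∈ Fin n ] (q ∉ X × g q ≡ suc t)
    absent-at-closing {t} gapₜ ¬gap with any? (λ q → ¬? (q ∈? X) ×-dec g q ≟ suc t)
    ... | yes found = found
    ... | no ∄q = contradiction (begin-strict
            prefix g (suc t) Y                   ≡⟨ prefix-suc g t Y ⟩
            prefix g t Y + layer g (suc t) Y     <⟨ +-mono-<-≤ gapₜ (layer-mono g Y⊆X) ⟩
            prefix g t X + layer g (suc t) X     ≡⟨ prefix-suc g t X ⟨
            prefix g (suc t) X                   ∎) ¬gap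
      where
      open ≤-Reasoning
      Y⊆X : ∀ {s} → s ∈ Y → g s ≡ suc t → s ∈ X
      Y⊆X {s} _ gs≡1+t = decidable-stable (s ∈? X) (λ s∉X → ∄q (s , s∉X , gs≡1+t))

  -- Starting from the least level a with a gap, p is a member of X at level a and the gap
  -- either persists above a (drop p) or closes first at the level b of some q ∉ X (swap p for q).
  descent : ∀ {B} → (∀ p → g p ≤ B) → ∀ {X Y t₀} → Gap X Y t₀ → Descent X Y
  descent {B} g≤B {X} {Y} {t₀} gap₀ with least< (λ t → prefix g t Y <? prefix g t X) (suc t₀)
  ... | inj₁ none = contradiction gap₀ (none t₀ ≤-refl)
  ... | inj₂ (a , _ , gapₐ , before-a) with member-at-first-gap {X} {Y} gapₐ before-a
  ... | p , p∈X , refl = closing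
    where
    Closed : ℕ → Set
    Closed t = g p < t × ¬ Gap X Y t
    gap-from : ∀ t → g p ≤ t → ¬ Closed t → Gap X Y t
    gap-from t gp≤t ¬closed with m≤n⇒m<n∨m≡n gp≤t
    ... | inj₂ refl = gapₐ
    ... | inj₁ gp<t = decidable-stable (_ <? _) (λ ¬gap → ¬closed (gp<t , ¬gap))
    closing : Descent X Y
    closing with least< (λ t → g p <? t ×-dec ¬? (prefix g t Y <? prefix g t X)) (suc B)
    ... | inj₁ never = drop p∈X (drop-improves p∈X gap-above)
      where
      gap-above : ∀ t → g p ≤ t → Gap X Y t
      gap-above t gp≤t with t ≤? B
      ... | yes t≤B = gap-from t gp≤t (never t (s≤s t≤B))
      ... | no t≰B  = subst₂ _<_ (sym (prefix-stable g g≤B Y B≤t)) (sym (prefix-stable g g≤B X B≤t))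
                        (gap-from B (g≤B p) (never B ≤-refl))
        where B≤t = <⇒≤ (≰⇒> t≰B)
    ... | inj₂ (zero , _ , (() , _) , _)
    ... | inj₂ (suc b , _ , (gp<1+b , ¬gap) , before-b) with absent-at-closing {X} {Y} gap-before ¬gap
      where
      gap-before : Gap X Y b
      gap-before = gap-from b (≤-pred gp<1+b) (before-b b ≤-refl)
    ...   | q , q∉X , gq≡1+b = swap p∈X q∉X (subst (g p <_) (sym gq≡1+b) gp<1+b)
              (swap-improves p∈X q∉X (subst (g p <_) (sym gq≡1+b) gp<1+b)
                (λ t gp≤t t<gq → gap-from t gp≤t (before-b t (subst (t <_) gq≡1+b t<gq))))

module _ {m : ℕ} where

  weigh : (Fin m → ℕ) → (Fin m → ℕ) → ℕ
  weigh w μ = sum (λ a → w a * μ a)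

  weigh-mono : ∀ w {μ ν} → (∀ a → μ a ≤ ν a) → weigh w μ ≤ weigh w ν
  weigh-mono w μ≤ν = sum-mono-≤ (λ a → *-monoʳ-≤ (w a) (μ≤ν a))

  weigh-balance : ∀ {μ ν i j} → (∀ a → ν a + 𝟙 (a ≡ᵇ i) ≡ μ a + 𝟙 (a ≡ᵇ j)) →
                  ∀ w → weigh w ν + w i ≡ weigh w μ + w j
  weigh-balance {μ} {ν} {i} {j} balanced w = begin
    weigh w ν + w i                                    ≡⟨ cong (weigh w ν +_) (sum-pick w i) ⟨
    weigh w ν + sum (λ a → w a * 𝟙 (a ≡ᵇ i))           ≡⟨ ∑-distrib-+ (λ a → w a * ν a) _ ⟨
    sum (λ a → w a * ν a + w a * 𝟙 (a ≡ᵇ i))           ≡⟨ sum-cong-≗ (λ a → *-distribˡ-+ (w a) (ν a) _) ⟨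
    sum (λ a → w a * (ν a + 𝟙 (a ≡ᵇ i)))               ≡⟨ sum-cong-≗ (λ a → cong (w a *_) (balanced a)) ⟩
    sum (λ a → w a * (μ a + 𝟙 (a ≡ᵇ j)))               ≡⟨ sum-cong-≗ (λ a → *-distribˡ-+ (w a) (μ a) _) ⟩
    sum (λ a → w a * μ a + w a * 𝟙 (a ≡ᵇ j))           ≡⟨ ∑-distrib-+ (λ a → w a * μ a) _ ⟩
    weigh w μ + sum (λ a → w a * 𝟙 (a ≡ᵇ j))           ≡⟨ cong (weigh w μ +_) (sum-pick w j) ⟩
    weigh w μ + w j                                    ∎
    where open ≡-Reasoning

  prefixSum : ℕ → (Fin m → ℕ) → ℕ
  prefixSum t = weigh (λ a → 𝟙 ⌊ toℕ a ≤? t ⌋)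

  prefixSum-cong : ∀ {μ ν} → (∀ a → μ a ≡ ν a) → ∀ t → prefixSum t μ ≡ prefixSum t ν
  prefixSum-cong μ≗ν t = sum-cong-≗ (λ a → cong (𝟙 ⌊ toℕ a ≤? t ⌋ *_) (μ≗ν a))

  prefixSum-monoˡ : ∀ {t t'} μ → t ≤ t' → prefixSum t μ ≤ prefixSum t' μ
  prefixSum-monoˡ {t} {t'} μ t≤t' = sum-mono-≤ λ a → *-monoˡ-≤ (μ a) (𝟙-mono λ a≤t →
    ⌊⌋-complete (toℕ a ≤? t') (≤-trans (⌊⌋-sound (toℕ a ≤? t) a≤t) t≤t'))

  prefixSum-total : ∀ μ → prefixSum m μ ≡ sum μ
  prefixSum-total μ = sum-cong-≗ λ a →
    trans (cong (λ b → 𝟙 b * μ a) (⌊⌋-complete (toℕ a ≤? m) (<⇒≤ (toℕ<n a)))) (+-identityʳ (μ a))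

  prefixSum-split : ∀ (a : Fin m) μ → prefixSum (toℕ a) μ ≡ weigh (λ b → below (toℕ a) (toℕ b)) μ + μ a
  prefixSum-split a μ = begin
    prefixSum (toℕ a) μ                                               ≡⟨ sum-cong-≗ split ⟩
    sum (λ b → below (toℕ a) (toℕ b) * μ b + μ b * 𝟙 (b ≡ᵇ a))        ≡⟨ ∑-distrib-+ (λ b → below (toℕ a) (toℕ b) * μ b) _ ⟩
    weigh (λ b → below (toℕ a) (toℕ b)) μ + sum (λ b → μ b * 𝟙 (b ≡ᵇ a)) ≡⟨ cong (weigh (λ b → below (toℕ a) (toℕ b)) μ +_) (sum-pick μ a) ⟩
    weigh (λ b → below (toℕ a) (toℕ b)) μ + μ a                       ∎
    where
    open ≡-Reasoning
    split : ∀ b → 𝟙 ⌊ toℕ b ≤? toℕ a ⌋ * μ b ≡ below (toℕ a) (toℕ b) * μ b + μ b * 𝟙 (b ≡ᵇ a)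
    split b = begin
      𝟙 ⌊ toℕ b ≤? toℕ a ⌋ * μ b                                ≡⟨ cong (_* μ b) (𝟙≤?-split (toℕ b) (toℕ a)) ⟩
      (below (toℕ a) (toℕ b) + 𝟙 ⌊ toℕ b ≟ toℕ a ⌋) * μ b        ≡⟨ *-distribʳ-+ (μ b) (below (toℕ a) (toℕ b)) _ ⟩
      below (toℕ a) (toℕ b) * μ b + 𝟙 ⌊ toℕ b ≟ toℕ a ⌋ * μ b    ≡⟨ cong (λ x → below (toℕ a) (toℕ b) * μ b + 𝟙 x * μ b) (⌊toℕ≟toℕ⌋ b a) ⟩
      below (toℕ a) (toℕ b) * μ b + 𝟙 (b ≡ᵇ a) * μ b            ≡⟨ cong (below (toℕ a) (toℕ b) * μ b +_) (*-comm (𝟙 (b ≡ᵇ a)) (μ b)) ⟩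
      below (toℕ a) (toℕ b) * μ b + μ b * 𝟙 (b ≡ᵇ a)            ∎

  prefixSum-injective : ∀ {μ ν} → (∀ t → t < m → prefixSum t μ ≡ prefixSum t ν) → ∀ a → μ a ≡ ν a
  prefixSum-injective {μ} {ν} same a = +-cancelˡ-≡ (weigh lower μ) _ _ (begin
    weigh lower μ + μ a   ≡⟨ prefixSum-split a μ ⟨
    prefixSum (toℕ a) μ   ≡⟨ same (toℕ a) (toℕ<n a) ⟩
    prefixSum (toℕ a) ν   ≡⟨ prefixSum-split a ν ⟩
    weigh lower ν + ν a   ≡⟨ cong (_+ ν a) lower-same ⟨
    weigh lower μ + ν a   ∎)
    where
    open ≡-Reasoning
    lower : Fin m → ℕ
    lower b = below (toℕ a) (toℕ b)
    lower-same : weigh lower μ ≡ weigh lower ν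
    lower-same with toℕ a | toℕ<n a
    ... | zero  | _     = trans (sum-zero {m} (λ _ → refl)) (sym (sum-zero {m} (λ _ → refl)))
    ... | suc t | 1+t<m = same t (<-trans (n<1+n t) 1+t<m)

module Profile {n : ℕ} (G : SimpleGame n) {m : ℕ} (R : CanonicalRanking G m) where
  open CanonicalRanking R public
  open Canonical G R public

  rank : Fin n → ℕ
  rank p = toℕ (c p)

  rank-monotone : ∀ p q → rank p ≤ rank q → _≽_ G p q
  rank-monotone p q = Equivalence.to (c-order p q)

  profile : Subset n → Multiset
  profile X a = count G (inClass a) X

  profile-valid : ∀ X → Valid (profile X)
  profile-valid X a = subst₂ _≤_ (sym (∣∩tabulate∣≡# (inClass a) X)) (sym (∣∩tabulate∣≡# (inClass a) full))
    (#-mono {X = X} {Y = full} λ s Xs∧cs≡a → ∧-≡true⁺ (lookup∘tabulate _ s) (proj₂ (∧-≡true⁻ Xs∧cs≡a)))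

  prefixSum-profile : ∀ t X → prefixSum t (profile X) ≡ prefix rank t X
  prefixSum-profile t X = begin
    sum (λ a → 𝟙 ⌊ toℕ a ≤? t ⌋ * profile X a)
      ≡⟨ sum-cong-≗ (λ a → cong (𝟙 ⌊ toℕ a ≤? t ⌋ *_) (∣∩tabulate∣≡# (inClass a) X)) ⟩
    sum (λ a → 𝟙 ⌊ toℕ a ≤? t ⌋ * sum (λ s → 𝟙 (lookup X s ∧ inClass a s)))
      ≡⟨ sum-cong-≗ (λ a → *-distribˡ-sum (𝟙 ⌊ toℕ a ≤? t ⌋) (λ s → 𝟙 (lookup X s ∧ inClass a s))) ⟩
    sum (λ a → sum (λ s → 𝟙 ⌊ toℕ a ≤? t ⌋ * 𝟙 (lookup X s ∧ inClass a s)))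
      ≡⟨ ∑-comm (λ a s → 𝟙 ⌊ toℕ a ≤? t ⌋ * 𝟙 (lookup X s ∧ inClass a s)) ⟩
    sum (λ s → sum (λ a → 𝟙 ⌊ toℕ a ≤? t ⌋ * 𝟙 (lookup X s ∧ inClass a s)))
      ≡⟨ sum-cong-≗ (λ s → trans (sum-cong-≗ (pointwise s)) (sum-pick (λ a → 𝟙 (lookup X s ∧ ⌊ toℕ a ≤? t ⌋)) (c s))) ⟩
    prefix rank t X ∎
    where
    open ≡-Reasoning
    pointwise : ∀ s a → 𝟙 ⌊ toℕ a ≤? t ⌋ * 𝟙 (lookup X s ∧ inClass a s)
                      ≡ 𝟙 (lookup X s ∧ ⌊ toℕ a ≤? t ⌋) * 𝟙 (a ≡ᵇ c s)
    pointwise s a with lookup X s | a ≟ᶠ c s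
    ... | false | _      = *-zeroʳ (𝟙 ⌊ toℕ a ≤? t ⌋)
    ... | true  | yes refl = cong (𝟙 ⌊ toℕ a ≤? t ⌋ *_) (cong 𝟙 (⌊⌋-complete (a ≟ᶠ a) refl))
    ... | true  | no a≢cs = trans (cong (𝟙 ⌊ toℕ a ≤? t ⌋ *_) (cong 𝟙 (⌊⌋-false (c s ≟ᶠ a) (a≢cs ∘ sym))))
                                   (trans (*-zeroʳ (𝟙 ⌊ toℕ a ≤? t ⌋)) (sym (*-zeroʳ (𝟙 (⌊ toℕ a ≤? t ⌋)))))

  prefixSum-realised : ∀ {X μ} → (∀ a → profile X a ≡ μ a) → ∀ t → prefixSum t μ ≡ prefix rank t X
  prefixSum-realised {X} X↦μ t = trans (sym (prefixSum-cong X↦μ t)) (prefixSum-profile t X)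

  profile≡# : ∀ X a → profile X a ≡ #[ inClass a ] X
  profile≡# X a = ∣∩tabulate∣≡# (inClass a) X

  inClass-own : ∀ p → inClass (c p) p ≡ true
  inClass-own p = ⌊⌋-complete (c p ≟ᶠ c p) refl

  inClass-other : ∀ {p a} → c p ≢ a → inClass a p ≡ false
  inClass-other {p} {a} = ⌊⌋-false (c p ≟ᶠ a)

  profile-remove : ∀ {X p} → p ∈ X → ∀ a → profile (remove X p) a + 𝟙 (inClass a p) ≡ profile X a
  profile-remove {X} {p} p∈X a = begin
    profile (remove X p) a + 𝟙 (inClass a p)     ≡⟨ cong (_+ 𝟙 (inClass a p)) (profile≡# (remove X p) a) ⟩
    #[ inClass a ] (remove X p) + 𝟙 (inClass a p) ≡⟨ #-remove (inClass a) p∈X ⟩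
    #[ inClass a ] X                              ≡⟨ profile≡# X a ⟨
    profile X a                                   ∎
    where open ≡-Reasoning

  profile-exchange : ∀ {X p q} → p ∈ X → q ∉ X → ∀ a →
                     profile (exchange X p q) a + 𝟙 (inClass a p) ≡ profile X a + 𝟙 (inClass a q)
  profile-exchange {X} {p} {q} p∈X q∉X a = begin
    profile (exchange X p q) a + 𝟙 (inClass a p)       ≡⟨ cong (_+ 𝟙 (inClass a p)) (profile≡# (exchange X p q) a) ⟩
    #[ inClass a ] (exchange X p q) + 𝟙 (inClass a p)  ≡⟨ #-exchange (inClass a) p∈X q∉X ⟩
    #[ inClass a ] X + 𝟙 (inClass a q)                 ≡⟨ cong (_+ 𝟙 (inClass a q)) (profile≡# X a) ⟨
    profile X a + 𝟙 (inClass a q)                      ∎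
    where open ≡-Reasoning

  remove-⊂ₘ : ∀ {X μ p} → (∀ a → profile X a ≡ μ a) → p ∈ X → profile (remove X p) ⊂ₘ μ
  remove-⊂ₘ {X} {μ} {p} X↦μ p∈X =
      (λ a → ≤-trans (m≤m+n _ _) (≤-reflexive (trans (profile-remove p∈X a) (X↦μ a))))
    , (λ same → m+1+n≢m (profile (remove X p) (c p)) (begin
        profile (remove X p) (c p) + 1                        ≡⟨ cong (λ b → profile (remove X p) (c p) + 𝟙 b) (inClass-own p) ⟨
        profile (remove X p) (c p) + 𝟙 (inClass (c p) p)      ≡⟨ profile-remove p∈X (c p) ⟩
        profile X (c p)                                       ≡⟨ X↦μ (c p) ⟩
        μ (c p)                                               ≡⟨ same (c p) ⟨
        profile (remove X p) (c p)                            ∎))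
    where open ≡-Reasoning

  exchange-shift : ∀ {X μ p q} → (∀ a → profile X a ≡ μ a) → p ∈ X → q ∉ X → rank p < rank q →
                   Shift μ (profile (exchange X p q))
  exchange-shift {X} {μ} {p} {q} X↦μ p∈X q∉X rp<rq =
    c p , c q , rp<rq , occupied , unfilled , at-source , at-target , elsewhere
    where
    cp≢cq : c p ≢ c q
    cp≢cq cp≡cq = <-irrefl (cong toℕ cp≡cq) rp<rq
    X' = exchange X p q
    moved : ∀ a → profile X' a + 𝟙 (inClass a p) ≡ μ a + 𝟙 (inClass a q)
    moved a = trans (profile-exchange p∈X q∉X a) (cong (_+ 𝟙 (inClass a q)) (X↦μ a))
    occupied : 1 ≤ μ (c p)
    occupied = subst (1 ≤_) (trans (profile-remove p∈X (c p)) (X↦μ (c p)))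
      (≤-trans (≤-reflexive (cong 𝟙 (sym (inClass-own p)))) (m≤n+m _ _))
    unfilled : μ (c q) < size (c q)
    unfilled = subst₂ _<_ (trans (sym (profile≡# X (c q))) (X↦μ (c q))) (sym (profile≡# full (c q)))
      (#-mono-< {X = X} {Y = full} (λ s Xs∧s∈cq → ∧-≡true⁺ (lookup∘tabulate _ s) (proj₂ (∧-≡true⁻ Xs∧s∈cq))) q
        (cong (_∧ inClass (c q) q) (∉⇒lookup≡false q∉X)) (∧-≡true⁺ (lookup∘tabulate _ q) (inClass-own q)))
    at-source : profile X' (c p) ≡ μ (c p) ∸ 1
    at-source = sym (trans (cong (_∸ 1) (sym (begin
      profile X' (c p) + 1                         ≡⟨ cong (λ b → profile X' (c p) + 𝟙 b) (inClass-own p) ⟨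
      profile X' (c p) + 𝟙 (inClass (c p) p)       ≡⟨ moved (c p) ⟩
      μ (c p) + 𝟙 (inClass (c p) q)                ≡⟨ cong (λ b → μ (c p) + 𝟙 b) (inClass-other (cp≢cq ∘ sym)) ⟩
      μ (c p) + 0                                  ≡⟨ +-identityʳ _ ⟩
      μ (c p)                                      ∎))) (m+n∸n≡m _ 1))
      where open ≡-Reasoning
    at-target : profile X' (c q) ≡ suc (μ (c q))
    at-target = begin
      profile X' (c q)                             ≡⟨ +-identityʳ _ ⟨
      profile X' (c q) + 0                         ≡⟨ cong (λ b → profile X' (c q) + 𝟙 b) (inClass-other cp≢cq) ⟨
      profile X' (c q) + 𝟙 (inClass (c q) p)       ≡⟨ moved (c q) ⟩
      μ (c q) + 𝟙 (inClass (c q) q)                ≡⟨ cong (λ b → μ (c q) + 𝟙 b) (inClass-own q) ⟩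
      μ (c q) + 1                                  ≡⟨ +1≡suc _ ⟩
      suc (μ (c q))                                ∎
      where open ≡-Reasoning
    elsewhere : ∀ a → a ≢ c p → a ≢ c q → profile X' a ≡ μ a
    elsewhere a a≢cp a≢cq = begin
      profile X' a                                 ≡⟨ +-identityʳ _ ⟨
      profile X' a + 0                             ≡⟨ cong (λ b → profile X' a + 𝟙 b) (inClass-other (a≢cp ∘ sym)) ⟨
      profile X' a + 𝟙 (inClass a p)               ≡⟨ moved a ⟩
      μ a + 𝟙 (inClass a q)                        ≡⟨ cong (λ b → μ a + 𝟙 b) (inClass-other (a≢cq ∘ sym)) ⟩
      μ a + 0                                      ≡⟨ +-identityʳ _ ⟩
      μ a                                          ∎
      where open ≡-Reasoning

  potential : Multiset → ℕ
  potential = weigh (λ a → suc (m ∸ toℕ a))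

  source target : ∀ {μ ν} → Shift μ ν → Fin m
  source = proj₁
  target = proj₁ ∘ proj₂

  shift-balanced : ∀ {μ ν} (sh : Shift μ ν) a → ν a + 𝟙 (a ≡ᵇ source sh) ≡ μ a + 𝟙 (a ≡ᵇ target sh)
  shift-balanced {μ} {ν} (i , j , i<j , 1≤μi , _ , νi , νj , νk) a with a ≟ᶠ i | a ≟ᶠ j
  ... | yes refl | yes refl = contradiction i<j (<-irrefl refl)
  ... | yes refl | no _     = trans (cong (_+ 1) νi) (trans (m∸n+n≡m 1≤μi) (sym (+-identityʳ _)))
  ... | no _     | yes refl = trans (+-identityʳ _) (trans νj (sym (+1≡suc _)))
  ... | no a≢i   | no a≢j   = cong (_+ 0) (νk a a≢i a≢j)

  shift-lowers : ∀ {μ ν} (sh : Shift μ ν) w → w (target sh) ≤ w (source sh) → weigh w ν ≤ weigh w μ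
  shift-lowers {μ} {ν} sh w wj≤wi = +-cancelʳ-≤ (w (source sh)) (weigh w ν) (weigh w μ)
    (≤-trans (≤-reflexive (weigh-balance (shift-balanced sh) w)) (+-monoʳ-≤ (weigh w μ) wj≤wi))

  shift-lowers-strictly : ∀ {μ ν} (sh : Shift μ ν) w → w (target sh) < w (source sh) → weigh w ν < weigh w μ
  shift-lowers-strictly {μ} {ν} sh w wj<wi = +-cancelʳ-< (w (source sh)) (weigh w ν) (weigh w μ)
    (≤-<-trans (≤-reflexive (weigh-balance (shift-balanced sh) w)) (+-monoʳ-< (weigh w μ) wj<wi))

  shift-lowers-prefixSum : ∀ {μ ν} → Shift μ ν → ∀ t → prefixSum t ν ≤ prefixSum t μ
  shift-lowers-prefixSum sh@(i , j , i<j , _) t = shift-lowers sh _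
    (𝟙-mono λ j≤t → ⌊⌋-complete (toℕ i ≤? t) (≤-trans (<⇒≤ i<j) (⌊⌋-sound (toℕ j ≤? t) j≤t)))

  shift-lowers-prefixSum-at-source : ∀ {μ ν} (sh : Shift μ ν) → prefixSum (toℕ (source sh)) ν < prefixSum (toℕ (source sh)) μ
  shift-lowers-prefixSum-at-source sh@(i , j , i<j , _) = shift-lowers-strictly sh _
    (subst₂ _<_ (cong 𝟙 (sym (⌊⌋-false (toℕ j ≤? toℕ i) (<⇒≱ i<j)))) (cong 𝟙 (sym (⌊⌋-complete (toℕ i ≤? toℕ i) ≤-refl))) ≤-refl)

  shift-lowers-potential : ∀ {μ ν} → Shift μ ν → potential ν < potential μ
  shift-lowers-potential sh@(i , j , i<j , _) = shift-lowers-strictly sh _ (s≤s (∸-monoʳ-< i<j (<⇒≤ (toℕ<n j))))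

  ⊂ₘ-lowers-prefixSum : ∀ {μ ν} → ν ⊂ₘ μ → ∀ t → prefixSum t ν ≤ prefixSum t μ
  ⊂ₘ-lowers-prefixSum (ν≤μ , _) t = weigh-mono (λ a → 𝟙 ⌊ toℕ a ≤? t ⌋) ν≤μ

  ⊂ₘ-lowers-potential : ∀ {μ ν} → ν ⊂ₘ μ → potential ν < potential μ
  ⊂ₘ-lowers-potential {μ} {ν} (ν≤μ , ν≢μ) with all? (λ a → ν a ≟ μ a)
  ... | yes ν≡μ = contradiction ν≡μ ν≢μ
  ... | no ν≢μ' with ¬∀⟶∃¬ m (λ a → ν a ≡ μ a) (λ a → ν a ≟ μ a) ν≢μ'
  ...   | a , νa≢μa = sum-mono-< (λ b → *-monoʳ-≤ (suc (m ∸ toℕ b)) (ν≤μ b)) a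
                        (*-monoʳ-< (suc (m ∸ toℕ a)) (≤∧≢⇒< (ν≤μ a) νa≢μa))

-- Canonical rankings of complete games

image-downward-closed : ∀ {n} (h : Fin n → ℕ) → (∀ {p v} → h p ≡ suc v → Σ[ q ∈ Fin n ] h q ≡ v) →
                        ∀ p k → k ≤ h p → Σ[ q ∈ Fin n ] h q ≡ k
image-downward-closed h pred-closed p k k≤hp = go (h p) p refl k≤hp
  where
  go : ∀ v p → h p ≡ v → k ≤ v → Σ[ q ∈ _ ] h q ≡ k
  go v p hp≡v k≤v with m≤n⇒m<n∨m≡n k≤v
  ... | inj₂ refl = p , hp≡v
  go (suc v) p hp≡1+v _ | inj₁ k<1+v with pred-closed hp≡1+v
  ... | q , hq≡v = go v q hq≡v (≤-pred k<1+v)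

module CanonicalFromComplete {n : ℕ} (G : SimpleGame n) (total : ∀ p q → _≽_ G p q ⊎ _≽_ G q p) where

  _≻_ _~_ : Fin n → Fin n → Set
  p ≻ q = _≽_ G p q × ¬ _≽_ G q p
  p ~ q = _≽_ G p q × _≽_ G q p

  Representative : Fin n → Set
  Representative q = ∀ q' → toℕ q' < toℕ q → ¬ q' ~ q

  -- Opaque, so that the search over all subsets inside ≽-dec is never unfolded by the type checker.
  opaque
    _≽ᵇ_ _≻ᵇ_ : Fin n → Fin n → Bool
    p ≽ᵇ q = ⌊ ≽-dec G p q ⌋
    p ≻ᵇ q = ⌊ ≽-dec G p q ×-dec ¬? (≽-dec G q p) ⌋

    isRep : Fin n → Bool
    isRep q = ⌊ all? (λ q' → toℕ q' <? toℕ q →-dec ¬? (≽-dec G q' q ×-dec ≽-dec G q q')) ⌋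

    ≽ᵇ-complete : ∀ {p q} → _≽_ G p q → p ≽ᵇ q ≡ true
    ≽ᵇ-complete = ⌊⌋-complete (≽-dec G _ _)

    ≽ᵇ-false : ∀ {p q} → ¬ _≽_ G p q → p ≽ᵇ q ≡ false
    ≽ᵇ-false = ⌊⌋-false (≽-dec G _ _)

    ≻ᵇ-sound : ∀ {p q} → p ≻ᵇ q ≡ true → p ≻ q
    ≻ᵇ-sound = ⌊⌋-sound (≽-dec G _ _ ×-dec ¬? (≽-dec G _ _))

    ≻ᵇ-complete : ∀ {p q} → p ≻ q → p ≻ᵇ q ≡ true
    ≻ᵇ-complete = ⌊⌋-complete (≽-dec G _ _ ×-dec ¬? (≽-dec G _ _))

    ≻ᵇ-false : ∀ {p q} → ¬ p ≻ q → p ≻ᵇ q ≡ false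
    ≻ᵇ-false = ⌊⌋-false (≽-dec G _ _ ×-dec ¬? (≽-dec G _ _))

    isRep-sound : ∀ {q} → isRep q ≡ true → Representative q
    isRep-sound {q} eq q' q'<q = ⌊⌋-sound (all? _) eq q' q'<q

    isRep-complete : ∀ {q} → Representative q → isRep q ≡ true
    isRep-complete {q} rep = ⌊⌋-complete (all? _) rep

  ≻-≽-trans : ∀ {p q r} → p ≻ q → _≽_ G q r → p ≻ r
  ≻-≽-trans (p≽q , q⋡p) q≽r = ≽-trans G p≽q q≽r , (λ r≽p → q⋡p (≽-trans G q≽r r≽p))

  ≽-≻-trans : ∀ {p q r} → _≽_ G p q → q ≻ r → p ≻ r
  ≽-≻-trans p≽q (q≽r , r⋡q) = ≽-trans G p≽q q≽r , (λ r≽p → r⋡q (≽-trans G r≽p p≽q))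

  representative : ∀ p → Σ[ r ∈ Fin n ] (isRep r ≡ true × r ~ p)
  representative p with argmin (λ r → ≽-dec G r p ×-dec ≽-dec G p r) toℕ
  ... | inj₁ none = contradiction (≽-refl G , ≽-refl G) (none p)
  ... | inj₂ (r , r~p , least) = r , isRep-complete minimal , r~p
    where
    minimal : Representative r
    minimal q' q'<r (q'≽r , r≽q') =
      <⇒≱ q'<r (least q' (≽-trans G q'≽r (proj₁ r~p) , ≽-trans G (proj₂ r~p) r≽q'))

  representative-unique : ∀ {r₁ r₂} → isRep r₁ ≡ true → isRep r₂ ≡ true → r₁ ~ r₂ → r₁ ≡ r₂
  representative-unique {r₁} {r₂} rep₁ rep₂ (r₁≽r₂ , r₂≽r₁) with <-cmp (toℕ r₁) (toℕ r₂)
  ... | tri< r₁<r₂ _ _ = contradiction (r₁≽r₂ , r₂≽r₁) (isRep-sound rep₂ r₁ r₁<r₂)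
  ... | tri≈ _ eq _    = toℕ-injective eq
  ... | tri> _ _ r₂<r₁ = contradiction (r₂≽r₁ , r₁≽r₂) (isRep-sound rep₁ r₂ r₂<r₁)

  classes : ℕ
  classes = #ᶠ isRep

  rank : Fin n → ℕ
  rank p = #ᶠ (λ r → isRep r ∧ r ≻ᵇ p)

  atLeast : Fin n → ℕ
  atLeast p = #ᶠ (λ r → isRep r ∧ r ≽ᵇ p)

  ≽⇒rank≤ : ∀ {p q} → _≽_ G p q → rank p ≤ rank q
  ≽⇒rank≤ {p} {q} p≽q = #ᶠ-mono {P = λ r → isRep r ∧ r ≻ᵇ p} {Q = λ r → isRep r ∧ r ≻ᵇ q} λ r rep∧r≻p → let (rep , r≻p) = ∧-≡true⁻ rep∧r≻p in
    ∧-≡true⁺ rep (≻ᵇ-complete (≻-≽-trans (≻ᵇ-sound r≻p) p≽q))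

  ⋡⇒rank> : ∀ {p q} → ¬ _≽_ G p q → rank q < rank p
  ⋡⇒rank> {p} {q} p⋡q with total p q | representative q
  ... | inj₁ p≽q | _ = contradiction p≽q p⋡q
  ... | inj₂ q≽p | r , rep , r~q = #ᶠ-mono-< {P = λ r → isRep r ∧ r ≻ᵇ q} {Q = λ r → isRep r ∧ r ≻ᵇ p} narrower r
    (trans (cong (isRep r ∧_) (≻ᵇ-false (λ r≻q → proj₂ r≻q (proj₂ r~q)))) (∧-zeroʳ (isRep r)))
    (∧-≡true⁺ rep (≻ᵇ-complete (≽-≻-trans (proj₁ r~q) (q≽p , p⋡q))))
    where
    narrower : ∀ r → isRep r ∧ r ≻ᵇ q ≡ true → isRep r ∧ r ≻ᵇ p ≡ true
    narrower r rep∧r≻q = let (rep , r≻q) = ∧-≡true⁻ rep∧r≻q in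
      ∧-≡true⁺ rep (≻ᵇ-complete (≻-≽-trans (≻ᵇ-sound r≻q) q≽p))

  rank<classes : ∀ p → rank p < classes
  rank<classes p with representative p
  ... | r , rep , r~p = #ᶠ-mono-< {P = λ r → isRep r ∧ r ≻ᵇ p} {Q = isRep} (λ _ → proj₁ ∘ ∧-≡true⁻) r
    (trans (cong (isRep r ∧_) (≻ᵇ-false (λ r≻p → proj₂ r≻p (proj₂ r~p)))) (∧-zeroʳ (isRep r))) rep

  ≽ᵇ≡≻ᵇ-off-class : ∀ {r p} → ¬ r ~ p → r ≽ᵇ p ≡ r ≻ᵇ p
  ≽ᵇ≡≻ᵇ-off-class {r} {p} r≁p with ≽-dec G r p
  ... | yes r≽p = trans (≽ᵇ-complete r≽p) (sym (≻ᵇ-complete (r≽p , λ p≽r → r≁p (r≽p , p≽r))))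
  ... | no r⋡p  = trans (≽ᵇ-false r⋡p) (sym (≻ᵇ-false (r⋡p ∘ proj₁)))

  -- the representative of p is the one class counted by atLeast p but not by rank p
  atLeast≡1+rank : ∀ p → atLeast p ≡ suc (rank p)
  atLeast≡1+rank p with representative p
  ... | r₀ , rep₀ , r₀~p = begin
    atLeast p                                           ≡⟨ sum-cong-≗ pointwise ⟩
    sum (λ r → 𝟙 (isRep r ∧ r ≻ᵇ p) + 1 * 𝟙 (r ≡ᵇ r₀))  ≡⟨ ∑-distrib-+ (λ r → 𝟙 (isRep r ∧ r ≻ᵇ p)) _ ⟩
    rank p + sum (λ r → 1 * 𝟙 (r ≡ᵇ r₀))                ≡⟨ cong (rank p +_) (sum-pick (λ _ → 1) r₀) ⟩
    rank p + 1                                          ≡⟨ +1≡suc _ ⟩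
    suc (rank p)                                        ∎
    where
    open ≡-Reasoning
    pointwise : ∀ r → 𝟙 (isRep r ∧ r ≽ᵇ p) ≡ 𝟙 (isRep r ∧ r ≻ᵇ p) + 1 * 𝟙 (r ≡ᵇ r₀)
    pointwise r with r ≟ᶠ r₀
    ... | yes refl rewrite rep₀ | ≽ᵇ-complete (proj₁ r₀~p) | ≻ᵇ-false (λ r≻p → proj₂ r≻p (proj₂ r₀~p)) = refl
    ... | no r≢r₀ with isRep r in rep
    ...   | false = refl
    ...   | true  = trans (cong 𝟙 (≽ᵇ≡≻ᵇ-off-class r≁p)) (sym (+-identityʳ _))
      where
      r≁p : ¬ r ~ p
      r≁p (r≽p , p≽r) = r≢r₀ (representative-unique rep rep₀
        (≽-trans G r≽p (proj₂ r₀~p) , ≽-trans G (proj₁ r₀~p) p≽r))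

  -- The lowest class q strictly above p is counted by atLeast q exactly as rank p counts.
  rank-pred-closed : ∀ {p v} → rank p ≡ suc v → Σ[ q ∈ Fin n ] rank q ≡ v
  rank-pred-closed {p} {v} rp≡1+v with argmax (λ r → (isRep r ≟ᵇ true) ×-dec (≽-dec G r p ×-dec ¬? (≽-dec G p r))) rank
  ... | inj₁ none = contradiction (trans (sym rp≡1+v) (sum-zero nothing-above)) (λ ())
    where
    nothing-above : ∀ r → 𝟙 (isRep r ∧ r ≻ᵇ p) ≡ 0
    nothing-above r with isRep r ∧ r ≻ᵇ p in rep∧r≻p
    ... | false = refl
    ... | true  = let (rep , r≻p) = ∧-≡true⁻ rep∧r≻p in contradiction (rep , ≻ᵇ-sound r≻p) (none r)
  ... | inj₂ (q , (repq , q≻p) , highest) = q , suc-injective (begin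
    suc (rank q)  ≡⟨ atLeast≡1+rank q ⟨
    atLeast q     ≡⟨ sum-cong-≗ (λ r → cong 𝟙 (same r)) ⟩
    rank p        ≡⟨ rp≡1+v ⟩
    suc v         ∎)
    where
    open ≡-Reasoning
    same : ∀ r → isRep r ∧ r ≽ᵇ q ≡ isRep r ∧ r ≻ᵇ p
    same r with isRep r in rep | ≽-dec G r q
    ... | false | _     = refl
    ... | true  | yes r≽q = trans (≽ᵇ-complete r≽q) (sym (≻ᵇ-complete (≽-≻-trans r≽q q≻p)))
    ... | true  | no r⋡q  = trans (≽ᵇ-false r⋡q) (sym (≻ᵇ-false λ r≻p →
                              <⇒≱ (⋡⇒rank> r⋡q) (highest r (rep , r≻p))))

  ranking : CanonicalRanking G classes
  ranking = record
    { c       = λ p → fromℕ< (rank<classes p)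
    ; c-surj  = surjective
    ; c-order = λ p q → mk⇔
        (λ cp≤cq → decidable-stable (≽-dec G p q) λ p⋡q →
           <⇒≱ (⋡⇒rank> p⋡q) (subst₂ _≤_ (toℕ-fromℕ< _) (toℕ-fromℕ< _) cp≤cq))
        (λ p≽q → subst₂ _≤_ (sym (toℕ-fromℕ< _)) (sym (toℕ-fromℕ< _)) (≽⇒rank≤ p≽q))
    }
    where
    surjective : ∀ (k : Fin classes) → Σ[ p ∈ Fin n ] fromℕ< (rank<classes p) ≡ k
    surjective k with argmax {P = λ _ → ⊤} (λ _ → yes tt) rank
    ... | inj₁ none = contradiction (subst (toℕ k <_) (sum-zero (λ r → contradiction tt (none r))) (toℕ<n k)) (λ ())
    ... | inj₂ (b , _ , highest) with image-downward-closed rank rank-pred-closed b (toℕ k) k≤rb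
      where
      bottom : ∀ q → _≽_ G q b
      bottom q = decidable-stable (≽-dec G q b) (λ q⋡b → <⇒≱ (⋡⇒rank> q⋡b) (highest q tt))
      classes≡1+rb : classes ≡ suc (rank b)
      classes≡1+rb = trans (sum-cong-≗ (λ r → cong 𝟙 (sym (trans (cong (isRep r ∧_) (≽ᵇ-complete (bottom r))) (∧-identityʳ _)))))
                           (atLeast≡1+rank b)
      k≤rb : toℕ k ≤ rank b
      k≤rb = ≤-pred (subst (toℕ k <_) classes≡1+rb (toℕ<n k))
    ... | p , rp≡k = p , toℕ-injective (trans (toℕ-fromℕ< _) rp≡k)

-- Conjunctive hierarchical games

module FromConjHierarchical {n : ℕ} (G : SimpleGame n) {m : ℕ} (H : ConjHierarchical G m) where
  open ConjHierarchical H

  level : Fin n → ℕ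
  level p = toℕ (lvl p)

  Meets : Subset n → Set
  Meets X = ∀ (i : Fin m) → k i ≤ prefix level (toℕ i) X

  win⇒meets : ∀ {X} → Win G X → Meets X
  win⇒meets {X} w i = subst (k i ≤_) (∣∩tabulate∣≡# _ X) (Equivalence.to (winning X) w i)

  meets⇒win : ∀ {X} → Meets X → Win G X
  meets⇒win {X} meets = Equivalence.from (winning X) (λ i → subst (k i ≤_) (sym (∣∩tabulate∣≡# _ X)) (meets i))

  level-monotone : ∀ p q → level p ≤ level q → _≽_ G p q
  level-monotone p q lp≤lq Z p∉Z q∉Z w = meets⇒win λ i → begin
    k i                                                ≤⟨ win⇒meets w i ⟩
    prefix level (toℕ i) (Z ∪ ⁅ q ⁆)                   ≡⟨ prefix-∪⁅⁆ level q∉Z ⟩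
    prefix level (toℕ i) Z + 𝟙 ⌊ level q ≤? toℕ i ⌋    ≤⟨ +-monoʳ-≤ _ (𝟙-mono (λ lq≤i →
                                                          ⌊⌋-complete (level p ≤? toℕ i) (≤-trans lp≤lq (⌊⌋-sound (level q ≤? toℕ i) lq≤i)))) ⟩
    prefix level (toℕ i) Z + 𝟙 ⌊ level p ≤? toℕ i ⌋    ≡⟨ prefix-∪⁅⁆ level p∉Z ⟨
    prefix level (toℕ i) (Z ∪ ⁅ p ⁆)                   ∎
    where open ≤-Reasoning

  total : ∀ p q → _≽_ G p q ⊎ _≽_ G q p
  total p q with ≤-total (level p) (level q)
  ... | inj₁ lp≤lq = inj₁ (level-monotone p q lp≤lq)
  ... | inj₂ lq≤lp = inj₂ (level-monotone q p lq≤lp)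

  complete : Complete G
  complete = record
    { isPreorder = record
      { isEquivalence = isEquivalence
      ; reflexive     = λ { refl → ≽-refl G }
      ; trans         = ≽-trans G
      }
    ; total = total
    }

  -- Opaque for the same reason as the decisions in CanonicalFromComplete.
  opaque
    classes : ℕ
    classes = CanonicalFromComplete.classes G total

    ranking : CanonicalRanking G classes
    ranking = CanonicalFromComplete.ranking G total

  open Profile G ranking

  -- Winning is closed under meets of level profiles, so descent yields a least level profile.
  LeastLevels : Subset n → Set
  LeastLevels T = Win G T × (∀ Y → Win G Y → ∀ (i : Fin m) → prefix level (toℕ i) T ≤ prefix level (toℕ i) Y)

  leastLevels : Σ[ T ∈ Subset n ] LeastLevels T
  leastLevels = go (<-wellFounded (levelWeight full)) (full-wins G)
    where
    levelWeight : Subset n → ℕ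
    levelWeight Z = sum (λ (i : Fin m) → prefix level (toℕ i) Z)
    lowered : ∀ {Z Y p Z'} → Win G Z → Win G Y → Improvement level Z Y p Z' → Win G Z' × levelWeight Z' < levelWeight Z
    lowered {p = p} wZ wY improved =
        meets⇒win (λ i → ≤-trans (⊓-glb (win⇒meets wZ i) (win⇒meets wY i)) (≥-min (toℕ i)))
      , sum-mono-< (λ i → ≤-orig (toℕ i)) (lvl p) <-orig
      where open Improvement improved
    go : ∀ {Z} → Acc _<_ (levelWeight Z) → Win G Z → Σ[ T ∈ Subset n ] LeastLevels T
    go {Z} (acc smaller) wZ with anySubset? (λ Y → Win? G Y ×-dec any? (λ i → prefix level (toℕ i) Y <? prefix level (toℕ i) Z))
    ... | no ∄lower = Z , wZ , λ Y wY i → ≮⇒≥ (λ gap → ∄lower (Y , wY , i , gap))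
    ... | yes (Y , wY , i , gap) with descent level (λ p → <⇒≤ (toℕ<n (lvl p))) gap
    ...   | drop _ improved       = let (wZ' , lighter) = lowered wZ wY improved in go (smaller lighter) wZ'
    ...   | swap _ _ _ improved   = let (wZ' , lighter) = lowered wZ wY improved in go (smaller lighter) wZ'

  T : Subset n
  T = proj₁ leastLevels

  T-wins : Win G T
  T-wins = proj₁ (proj₂ leastLevels)

  -- The players of rank at most t are exactly those of level at most that of the lowest one.
  rankPrefix-levelPrefix : ∀ t → (∀ X → prefix rank t X ≡ 0) ⊎ Σ[ i ∈ Fin m ] (∀ X → prefix rank t X ≡ prefix level (toℕ i) X)
  rankPrefix-levelPrefix t with argmax (λ s → rank s ≤? t) level
  ... | inj₁ none = inj₁ λ X → sum-zero λ s →
    trans (cong (λ b → 𝟙 (lookup X s ∧ b)) (⌊⌋-false (rank s ≤? t) (none s))) (cong 𝟙 (∧-zeroʳ (lookup X s)))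
  ... | inj₂ (p* , rp*≤t , lowest) = inj₂ (lvl p* , λ X → sum-cong-≗ (λ s → cong (λ b → 𝟙 (lookup X s ∧ b)) (same s)))
    where
    same : ∀ s → ⌊ rank s ≤? t ⌋ ≡ ⌊ level s ≤? level p* ⌋
    same s with rank s ≤? t
    ... | yes rs≤t = sym (⌊⌋-complete (level s ≤? level p*) (lowest s rs≤t))
    ... | no rs≰t  = sym (⌊⌋-false (level s ≤? level p*) λ ls≤lp* →
                      rs≰t (≤-trans (Equivalence.from (c-order s p*) (level-monotone s p* ls≤lp*)) rp*≤t))

  T-least : ∀ Y → Win G Y → ∀ t → prefix rank t T ≤ prefix rank t Y
  T-least Y wY t with rankPrefix-levelPrefix t
  ... | inj₁ empty      = ≤-trans (≤-reflexive (empty T)) z≤n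
  ... | inj₂ (i , same) = subst₂ _≤_ (sym (same T)) (sym (same Y)) (proj₂ (proj₂ leastLevels) Y wY i)

  τ : Multiset
  τ = profile T

  τ-shiftMinimal : ShiftMinimal τ
  τ-shiftMinimal = profile-valid T , (T , (λ _ → refl) , T-wins) , no-smaller , no-shift
    where
    no-smaller : ∀ ν → Valid ν → ν ⊂ₘ τ → ¬ WinM ν
    no-smaller ν _ (ν≤τ , ν≢τ) (Y , Y↦ν , wY) = ν≢τ (pointwise≤∧sum≥⇒≡ ν≤τ (begin
      sum τ                    ≡⟨ prefixSum-total τ ⟨
      prefixSum classes τ      ≡⟨ prefixSum-profile classes T ⟩
      prefix rank classes T    ≤⟨ T-least Y wY classes ⟩
      prefix rank classes Y    ≡⟨ prefixSum-realised {Y} Y↦ν classes ⟨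
      prefixSum classes ν      ≡⟨ prefixSum-total ν ⟩
      sum ν                    ∎))
      where open ≤-Reasoning
    no-shift : ∀ ν → Shift τ ν → ¬ WinM ν
    no-shift ν sh (Y , Y↦ν , wY) = <⇒≱ (shift-lowers-prefixSum-at-source sh) (begin
      prefixSum t τ    ≡⟨ prefixSum-profile t T ⟩
      prefix rank t T  ≤⟨ T-least Y wY t ⟩
      prefix rank t Y  ≡⟨ prefixSum-realised {Y} Y↦ν t ⟨
      prefixSum t ν    ∎)
      where
      open ≤-Reasoning
      t = toℕ (source sh)

  improvement-wins : ∀ {X p X'} → Win G X → Improvement rank X T p X' → Win G X'
  improvement-wins {X} wX improved = dominates G rank rank-monotone
    (λ r → ≤-trans (⊓-glb (T-least X wX (rank r)) ≤-refl) (Improvement.≥-min improved (rank r))) T-wins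

  -- A winning X with a profile other than τ has a prefix count above T's, and descent
  -- then produces a winning coalition whose profile is a proper part or a shift.
  τ-unique : ∀ μ → ShiftMinimal μ → ∀ a → μ a ≡ τ a
  τ-unique μ (_ , (X , X↦μ , wX) , no-smaller , no-shift)
    with any? (λ (i : Fin classes) → prefix rank (toℕ i) T <? prefix rank (toℕ i) X)
  ... | no ∄gap = prefixSum-injective λ t t<m → begin
    prefixSum t μ    ≡⟨ prefixSum-realised {X} X↦μ t ⟩
    prefix rank t X  ≡⟨ ≤-antisym (≮⇒≥ (λ gap → ∄gap (fromℕ< t<m , subst (λ u → prefix rank u T < prefix rank u X) (sym (toℕ-fromℕ< t<m)) gap)))
                                 (T-least X wX t) ⟩
    prefix rank t T  ≡⟨ prefixSum-profile t T ⟨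
    prefixSum t τ    ∎
    where open ≡-Reasoning
  ... | yes (i , gap) with descent rank (λ p → <⇒≤ (toℕ<n (c p))) gap
  ...   | drop {p} p∈X improved =
    ⊥-elim (no-smaller (profile (remove X p)) (profile-valid (remove X p)) (remove-⊂ₘ {X} X↦μ p∈X) (remove X p , (λ _ → refl) , improvement-wins wX improved))
  ...   | swap {p} {q} p∈X q∉X rp<rq improved =
    ⊥-elim (no-shift (profile (exchange X p q)) (exchange-shift {X} X↦μ p∈X q∉X rp<rq) (exchange X p q , (λ _ → refl) , improvement-wins wX improved))

  result : Complete G × CanonicalHasUniqueShiftMinimal G
  result = complete , classes , ranking , τ , τ-shiftMinimal , τ-unique

-- Games with a unique shift-minimal winning profile

module FromUniqueShiftMinimal {n : ℕ} (G : SimpleGame n) {m : ℕ} (R : CanonicalRanking G m)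
  (ℓ : Canonical.Multiset G R) (ℓ-minimal : Canonical.ShiftMinimal G R ℓ)
  (ℓ-unique : ∀ ℓ' → Canonical.ShiftMinimal G R ℓ' → ∀ a → ℓ' a ≡ ℓ a) where
  open Profile G R

  threshold : ℕ → ℕ
  threshold t = prefixSum t ℓ

  Meets : Multiset → Set
  Meets μ = ∀ (i : Fin m) → threshold (toℕ i) ≤ prefixSum (toℕ i) μ

  -- A winning profile failing a threshold would be shift-minimal, hence equal to ℓ.
  winningProfile-meets : ∀ {μ} → WinM μ → Meets μ
  winningProfile-meets {μ} = go (<-wellFounded (potential μ))
    where
    go : ∀ {μ} → Acc _<_ (potential μ) → WinM μ → Meets μ
    go {μ} (acc smaller) w@(X , X↦μ , _) with all? (λ i → threshold (toℕ i) ≤? prefixSum (toℕ i) μ)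
    ... | yes meets = meets
    ... | no fails = contradiction (λ i → ≤-reflexive (prefixSum-cong (λ a → sym (ℓ-unique μ μ-minimal a)) (toℕ i))) fails
      where
      μ-minimal : ShiftMinimal μ
      μ-minimal = (λ a → subst (_≤ size a) (X↦μ a) (profile-valid X a))
                , w
                , (λ ν _ ν⊂μ wν → fails (λ i → ≤-trans (go (smaller (⊂ₘ-lowers-potential ν⊂μ)) wν i)
                                                        (⊂ₘ-lowers-prefixSum ν⊂μ (toℕ i))))
                , (λ ν sh wν → fails (λ i → ≤-trans (go (smaller (shift-lowers-potential sh)) wν i)
                                                     (shift-lowers-prefixSum sh (toℕ i))))

  winning-meets : ∀ {X} → Win G X → ∀ (i : Fin m) → threshold (toℕ i) ≤ prefix rank (toℕ i) X
  winning-meets {X} w i = subst (threshold (toℕ i) ≤_) (prefixSum-profile (toℕ i) X)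
    (winningProfile-meets (X , (λ _ → refl) , w) i)

  meets-winning : ∀ {X} → (∀ (i : Fin m) → threshold (toℕ i) ≤ prefix rank (toℕ i) X) → Win G X
  meets-winning {X} meets with proj₁ (proj₂ ℓ-minimal)
  ... | X₀ , X₀↦ℓ , w₀ = dominates G rank rank-monotone (λ r → begin
    prefix rank (rank r) X₀          ≡⟨ prefixSum-profile (rank r) X₀ ⟨
    prefixSum (rank r) (profile X₀)  ≡⟨ prefixSum-cong X₀↦ℓ (rank r) ⟩
    threshold (rank r)               ≤⟨ meets (c r) ⟩
    prefix rank (rank r) X           ∎) w₀
    where open ≤-Reasoning

  plateau⇒≽ : ∀ {p q} (i : Fin m) → rank p ≡ suc (toℕ i) → rank q ≡ suc (rank p) →
              threshold (rank p) ≤ threshold (toℕ i) → _≽_ G q p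
  plateau⇒≽ {p} {q} i rp≡1+i rq≡1+rp plateau Z q∉Z p∉Z wp = meets-winning meets
    where
    meetsₚ : ∀ a → threshold (toℕ a) ≤ prefix rank (toℕ a) Z + 𝟙 ⌊ rank p ≤? toℕ a ⌋
    meetsₚ a = subst (threshold (toℕ a) ≤_) (prefix-∪⁅⁆ rank p∉Z) (winning-meets wp a)
    meetsₚ-if : ∀ a {b} → ⌊ rank p ≤? toℕ a ⌋ ≡ b → threshold (toℕ a) ≤ prefix rank (toℕ a) Z + 𝟙 b
    meetsₚ-if a eq = subst (λ b → threshold (toℕ a) ≤ prefix rank (toℕ a) Z + 𝟙 b) eq (meetsₚ a)
    meets : ∀ a → threshold (toℕ a) ≤ prefix rank (toℕ a) (Z ∪ ⁅ q ⁆)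
    meets a rewrite prefix-∪⁅⁆ rank {toℕ a} q∉Z with rank p ≤? toℕ a | rank q ≤? toℕ a
    ... | yes rp≤a | yes _ = meetsₚ-if a (⌊⌋-complete (rank p ≤? toℕ a) rp≤a)
    ... | no rp≰a  | no _  = meetsₚ-if a (⌊⌋-false (rank p ≤? toℕ a) rp≰a)
    ... | no rp≰a  | yes rq≤a = contradiction (≤-trans (n≤1+n _) (subst (_≤ toℕ a) rq≡1+rp rq≤a)) rp≰a
    ... | yes rp≤a | no rq≰a = begin
      threshold (toℕ a)                                     ≡⟨ cong threshold a≡rp ⟩
      threshold (rank p)                                    ≤⟨ plateau ⟩
      threshold (toℕ i)                                     ≤⟨ meetsₚ i ⟩
      prefix rank (toℕ i) Z + 𝟙 ⌊ rank p ≤? toℕ i ⌋         ≡⟨ cong (λ b → prefix rank (toℕ i) Z + 𝟙 b) rp≰i ⟩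
      prefix rank (toℕ i) Z + 0                             ≡⟨ +-identityʳ _ ⟩
      prefix rank (toℕ i) Z                                 ≤⟨ prefix-monoˡ rank Z i≤a ⟩
      prefix rank (toℕ a) Z                                 ≡⟨ +-identityʳ _ ⟨
      prefix rank (toℕ a) Z + 0                             ∎
      where
      open ≤-Reasoning
      a≡rp : toℕ a ≡ rank p
      a≡rp = ≤-antisym (≤-pred (subst (toℕ a <_) rq≡1+rp (≰⇒> rq≰a))) rp≤a
      rp≰i : ⌊ rank p ≤? toℕ i ⌋ ≡ false
      rp≰i = ⌊⌋-false (rank p ≤? toℕ i) (λ rp≤i → <-irrefl refl (subst (_≤ toℕ i) rp≡1+i rp≤i))
      i≤a : toℕ i ≤ toℕ a
      i≤a = ≤-trans (n≤1+n _) (≤-reflexive (trans (sym rp≡1+i) (sym a≡rp)))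

  thresholds-strict : ∀ (i j : Fin m) → toℕ j ≡ suc (toℕ i) → suc (toℕ j) < m →
                      threshold (toℕ i) < threshold (toℕ j)
  thresholds-strict i j j≡1+i 1+j<m with c-surj j | c-surj (fromℕ< 1+j<m)
  ... | p , refl | q , cq≡1+j = ≰⇒> λ plateau → <-irrefl refl
    (subst (_≤ rank p) rq≡1+rp (Equivalence.from (c-order q p) (plateau⇒≽ i j≡1+i rq≡1+rp plateau)))
    where
    rq≡1+rp : rank q ≡ suc (rank p)
    rq≡1+rp = trans (cong toℕ cq≡1+j) (toℕ-fromℕ< 1+j<m)

  conjHierarchical : ConjHierarchical G m
  conjHierarchical = record
    { lvl      = c
    ; lvl-surj = c-surj
    ; k        = λ i → threshold (toℕ i)
    ; k-mono   = λ i j j≡1+i → prefixSum-monoˡ ℓ (≤-trans (n≤1+n _) (≤-reflexive (sym j≡1+i)))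
    ; k-strict = thresholds-strict
    ; winning  = λ X → mk⇔
        (λ w i → subst (threshold (toℕ i) ≤_) (sym (∣∩tabulate∣≡# _ X)) (winning-meets w i))
        (λ meets → meets-winning (λ i → subst (threshold (toℕ i) ≤_) (∣∩tabulate∣≡# _ X) (meets i)))
    }

theorem8 : ∀ (n : ℕ) (G : SimpleGame n) →
    IsConjHierarchical G ⇔ (Complete G × CanonicalHasUniqueShiftMinimal G)
theorem8 n G = mk⇔
  (λ (m , H) → FromConjHierarchical.result G H)
  (λ (_ , m , R , ℓ , ℓ-minimal , ℓ-unique) → m , FromUniqueShiftMinimal.conjHierarchical G R ℓ ℓ-minimal ℓ-unique)
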